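{- Let $\mathcal{G}=(G,\mathcal{T},\mathcal{P})$ be a directed parametric graph template with nonnegative edge weights $w$ and let $s,t$ be vertices of the template graph $G$. Let $G'$ be the reweighted graph obtained by edge reweighting. Then the value of a maximum $s$-$t$ flow in $G'$ equals the value of the maximum all-$s$-$t$ flow of $\mathcal{G}$.
   Context: A parametric graph template $\mathcal{G}=(G,\mathcal{T},\mathcal{P})$ consists of a directed template graph $G=(V,E)$ with nonnegative edge weights $w$, a list of templates $\mathcal{T}=T_0,\dots,T_{k-1}$ with $\emptyset\neq T_i\subseteq V$, and positive integer parameters $P_0,\dots,P_{k-1}$. For $i\neq j$, either $T_i\cap T_j=\emptyset$, $T_i\subsetneq T_j$, or $T_j\subsetneq T_i$; the root template is $T_0=V$ with $P_0=1$. Inclusion induces a rooted template tree. $T(v)$ is the smallest template containing $v$. No skipping: for every edge $(u,v)$ with $T(u)\neq T(v)$, one of $T(u),T(v)$ is the parent of the other. The instantiation: while more than one template remains, pick a leaf template $T_i\neq T_0$; replace each $v\in T_i$ (in $V$ and every template containing it) by $P_i$ copies $v_1,\dots,v_{P_i}$ (instances of $v$); replace each edge $(u,v)$ with both endpoints in $T_i$ by $(u_j,v_j)$, each edge $(u,v)$ with only $u\in T_i$ by $(u_j,v)$, and symmetrically, $j=1,\dots,P_i$, copies keeping the weight; delete $T_i,P_i$. Instances are transitive. Edge reweighting: $G'$ has the same vertices and edges as $G$, with weight $w'(e)=w(e)\prod_{i\in I(e)}P_i$, where $I(e)$ is the set of indices of templates containing at least one endpoint of $e$. A maximum all-$s$-$t$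 flow of $\mathcal{G}$ is a maximum flow in the instantiation with all instances of $s$ as sources and all instances of $t$ as sinks, capacities given by weights.
   Formalization: The edge weights w and the flows on the edges take rational values rather than real ones. -}

module Defs where

open import Data.Nat as ℕ using (ℕ; zero; suc)
open import Data.Integer using (+_)
open import Data.Rational using (ℚ; 0ℚ; 1ℚ; _+_; _*_; _-_; _/_; _≤_)
open import Data.Fin as Fin using (Fin)
open import Data.Bool using (Bool; true; false; if_then_else_; _∨_)
open import Data.List as List using (List; []; _∷_; length; lookup; allFin; upTo; concatMap)
open import Data.Nat.ListAction using (product)
open import Data.List.Relation.Unary.All using (All)
open import Data.Vec as Vec using (Vec; []; _∷_; tabulate; toList)
import Data.Vec.Properties as VecP
import Data.Product.Properties as ProdP
import Data.Nat.Properties as ℕP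
import Data.Fin.Properties as FinP
open import Data.Product using (Σ; ∃; _×_; _,_)
open import Data.Sum using (_⊎_)
open import Relation.Nullary using (¬_)
open import Relation.Nullary.Decidable using (⌊_⌋)
open import Relation.Binary.PropositionalEquality using (_≡_; _≢_)
open import Relation.Binary.Definitions using (DecidableEquality)

-- Generic (multi-)flow networks with finitely many sources and sinks.
-- A network over a vertex type V is a list of weighted directed edges
-- (tail , head , capacity).  Multiple edges are allowed.

Edge : Set → Set
Edge V = V × V × ℚ

tail : ∀ {V} → Edge V → V
tail (u , _ , _) = u

head : ∀ {V} → Edge V → V
head (_ , v , _) = v

cap : ∀ {V} → Edge V → ℚ
cap (_ , _ , c) = c

Σℚ : ∀ {m} → (Fin m → ℚ) → ℚ
Σℚ {m} f = List.foldr _+_ 0ℚ (List.map f (allFin m))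

χ : Bool → ℚ
χ true  = 1ℚ
χ false = 0ℚ

module FlowNetwork {V : Set} (_≟_ : DecidableEquality V)
                   (es : List (Edge V)) (isSrc isSnk : V → Bool) where

  Assignment : Set
  Assignment = Fin (length es) → ℚ

  inflow : Assignment → V → ℚ
  inflow f x = Σℚ (λ i → if ⌊ head (lookup es i) ≟ x ⌋ then f i else 0ℚ)

  outflow : Assignment → V → ℚ
  outflow f x = Σℚ (λ i → if ⌊ tail (lookup es i) ≟ x ⌋ then f i else 0ℚ)

  record IsFlow (f : Assignment) : Set where
    field
      nonneg       : ∀ i → 0ℚ ≤ f i
      capacity     : ∀ i → f i ≤ cap (lookup es i)
      conservation : ∀ x → isSrc x ≡ false → isSnk x ≡ false →
                     inflow f x ≡ outflow f x

  value : Assignment → ℚ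
  value f = Σℚ (λ i → f i * (χ (isSrc (tail (lookup es i))) - χ (isSrc (head (lookup es i)))))

  IsMaxFlowValue : ℚ → Set
  IsMaxFlowValue x =
    (Σ Assignment λ f → IsFlow f × value f ≡ x) ×
    (∀ g → IsFlow g → value g ≤ x)

record ParamGraphTemplate : Set where
  field
    n     : ℕ
    edges : List (Edge (Fin n))
    k     : ℕ                       -- number of templates is suc k
    T     : Fin (suc k) → Fin n → Bool
    P     : Fin (suc k) → ℕ

module _ (𝒢 : ParamGraphTemplate) where
  open ParamGraphTemplate 𝒢

  _∈T_ : Fin n → Fin (suc k) → Set
  v ∈T i = T i v ≡ true

  Sub : Fin (suc k) → Fin (suc k) → Set
  Sub i j = ∀ v → v ∈T i → v ∈T j

  StrictSub : Fin (suc k) → Fin (suc k) → Set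
  StrictSub i j = Sub i j × ∃ λ v → v ∈T j × ¬ (v ∈T i)

  Disjoint : Fin (suc k) → Fin (suc k) → Set
  Disjoint i j = ∀ v → v ∈T i → ¬ (v ∈T j)

  IsSmallestTemplate : Fin n → Fin (suc k) → Set
  IsSmallestTemplate v i = v ∈T i × (∀ j → v ∈T j → Sub i j)

  IsParent : Fin (suc k) → Fin (suc k) → Set
  IsParent p c = StrictSub c p × (∀ l → StrictSub c l → Sub p l)

  record WellFormed : Set where
    field
      nonnegWeights : All (λ e → 0ℚ ≤ cap e) edges
      nonempty      : ∀ i → ∃ λ v → v ∈T i
      laminar       : ∀ i j → i ≢ j → Disjoint i j ⊎ StrictSub i j ⊎ StrictSub j i
      rootAll       : ∀ v → v ∈T Fin.zero
      rootParam     : P Fin.zero ≡ 1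
      paramPos      : ∀ i → 1 ℕ.≤ P i
      noSkipping    : All (λ e → ∀ i j → IsSmallestTemplate (tail e) i →
                                 IsSmallestTemplate (head e) j → i ≢ j →
                                 IsParent i j ⊎ IsParent j i) edges

  -- Edge reweighting: w'(e) = w(e) * ∏_{i ∈ I(e)} P_i,
  -- I(e) = templates containing at least one endpoint of e.

  factor : Fin n → Fin n → ℕ
  factor u v = product (List.map (λ i → if T i u ∨ T i v then P i else 1) (allFin (suc k)))

  reweightEdge : Edge (Fin n) → Edge (Fin n)
  reweightEdge (u , v , w) = (u , v , w * ((+ factor u v) / 1))

  reweighted : List (Edge (Fin n))
  reweighted = List.map reweightEdge edges

  -- Instantiation (closed form of the iterative instantiation).
  -- An instance of v is (v , c) where c : Vec ℕ (suc k) records, for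
  -- every template T_i containing v, which of the P_i copies was taken
  -- (c_i < P_i), and c_i = 0 for templates not containing v.
  -- An instance of edge e = (u,v) is given by a copy index c_i < P_i for
  -- every i ∈ I(e); it joins the instances of u and v obtained by
  -- restricting c to the templates containing u, resp. v.

  InstVertex : Set
  InstVertex = Fin n × Vec ℕ (suc k)

  _≟I_ : DecidableEquality InstVertex
  _≟I_ = ProdP.≡-dec FinP._≟_ (VecP.≡-dec ℕP._≟_)

  allBelow : ∀ {m} → Vec ℕ m → List (Vec ℕ m)
  allBelow []       = [] ∷ []
  allBelow (b ∷ bs) = concatMap (λ x → List.map (x ∷_) (allBelow bs)) (upTo b)

  edgeBound : Fin n → Fin n → Vec ℕ (suc k)
  edgeBound u v = tabulate (λ i → if T i u ∨ T i v then P i else 1)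

  restrict : Fin n → Vec ℕ (suc k) → Vec ℕ (suc k)
  restrict u c = tabulate (λ i → if T i u then Vec.lookup c i else 0)

  instancesOf : Edge (Fin n) → List (Edge InstVertex)
  instancesOf (u , v , w) =
    List.map (λ c → ((u , restrict u c) , (v , restrict v c) , w)) (allBelow (edgeBound u v))

  instEdges : List (Edge InstVertex)
  instEdges = concatMap instancesOf edges

  MaxFlowValueReweighted : Fin n → Fin n → ℚ → Set
  MaxFlowValueReweighted s t =
    FlowNetwork.IsMaxFlowValue FinP._≟_ reweighted
      (λ x → ⌊ x FinP.≟ s ⌋) (λ x → ⌊ x FinP.≟ t ⌋)

  MaxAllFlowValue : Fin n → Fin n → ℚ → Set
  MaxAllFlowValue s t =
    FlowNetwork.IsMaxFlowValue _≟I_ instEdges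
      (λ x → ⌊ Data.Product.proj₁ x FinP.≟ s ⌋) (λ x → ⌊ Data.Product.proj₁ x FinP.≟ t ⌋)
    where import Data.Product

-- Take a maximum flow f and a minimum cut S of the reweighted graph G′; they exist by the
-- max-flow min-cut theorem, proved here by Ford–Fulkerson after scaling the rational
-- capacities to integers.  Spread f uniformly over the instances of each edge: the F(e)
-- instances of e = (u , v), where F(e) = ∏_{i ∈ I(e)} P_i, each carry f(e)/F(e).  An instance
-- (z , c) of a vertex z meets the same fraction κ(z , c) of the instances of every edge at z
-- (1/∏_{z ∈ T_i} P_i if c indexes an instance of z, and 0 otherwise), so the inflow and
-- outflow at (z , c) are κ(z , c) times those at z, and conservation is inherited.  The lifted
-- flow keeps the value of f, and the cut {(z , c) | z ∈ S} keeps the capacity of S, since each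
-- instance of e has weight w(e) = w′(e)/F(e).  By weak duality both values are maximal.

module Submission where

open import Defs
open import Data.Fin using (Fin; zero; suc)
open import Data.Rational using (ℚ)
open import Data.Product using (Σ; _×_; _,_; proj₁; proj₂)

open import Algebra.Bundles using (Ring)
open import Function using (_∘_; id)
open import Relation.Binary.Definitions using (DecidableEquality)
open import Relation.Binary.PropositionalEquality
  using (_≡_; _≢_; refl; sym; trans; cong; cong₂; subst; subst₂; module ≡-Reasoning)
open import Relation.Nullary using (Dec; yes; no; does; ¬_; contradiction)
open import Relation.Nullary.Decidable
  using (⌊_⌋; _×-dec_; _⊎-dec_; ⌊⌋-map′; isYes≗does; dec-true; dec-false)
open import Data.Bool using (Bool; true; false; if_then_else_; _∧_; _∨_; not)
import Data.Bool.Properties as BoolP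
open import Data.Bool.ListAction using (any)
import Data.Sum
open import Data.Sum using (_⊎_; inj₁; inj₂)
open import Data.Nat as ℕ using (ℕ; zero; suc)
import Data.Nat.Properties as ℕP
import Data.Nat.Coprimality as Coprime
open import Data.Nat.Divisibility using (_∣_; quotient)
open import Data.Nat.ListAction using (sum; product)
open import Data.Nat.ListAction.Properties using (∈⇒∣product; product≢0; sum-++)
import Data.Integer as ℤ
import Data.Integer.Properties as ℤP
open import Data.Rational as ℚ using (mkℚ; 0ℚ; 1ℚ; _+_; _*_; _-_; -_; _≤_; _/_; 1/_)
import Data.Rational.Properties as ℚP
import Data.Rational.Unnormalised as ℚᵘ
open import Data.Rational.Solver using (module +-*-Solver)
open +-*-Solver using (solve; _:+_; _:*_; _:-_; :-_; _:=_; con)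
import Data.Fin.Properties as FinP
open import Data.List as List using (List; []; _∷_; length; lookup; allFin)
import Data.List.Properties as ListP
open import Data.List.Relation.Unary.All as All using (All; []; _∷_)
import Data.List.Relation.Unary.All.Properties as AllP
open import Data.List.Membership.Propositional.Properties using (∈-map⁺; ∈-lookup)
open import Data.Vec as Vec using (Vec; []; _∷_)
import Data.Vec.Properties as VecP
open import Data.Vec.Functional using (updateAt)
open import Data.Vec.Functional.Properties using (updateAt-updates; updateAt-minimal)
open import Algebra.Properties.Group ℚP.+-0-group using (x∙y⁻¹≈ε⇒x≈y)
open import Algebra.Properties.Semiring.Sum (Ring.semiring ℚP.+-*-ring)
  renaming (sum to ∑) using (∑-distrib-+; *-distribʳ-sum; sum-cong-≗; sum-replicate-zero)
open import Algebra.Properties.CommutativeMonoid.Sum ℕP.*-1-commutativeMonoid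
  using () renaming (sum to ∏; ∑-distrib-+ to ∏-distrib-*; sum-cong-≗ to ∏-cong-≗)

ι : ℕ → ℚ
ι n = mkℚ (ℤ.+ n) 0 (Coprime.sym (Coprime.1-coprimeTo n))

n/1≡ι : ∀ n → ℤ.+ n / 1 ≡ ι n
n/1≡ι n = ℚP.↥p/↧p≡p (ι n)

ι-0 : ι 0 ≡ 0ℚ
ι-0 = sym (n/1≡ι 0)

ι-+ : ∀ m n → ι (m ℕ.+ n) ≡ ι m + ι n
ι-+ m n = begin
  ι (m ℕ.+ n)                       ≡⟨ sym (n/1≡ι (m ℕ.+ n)) ⟩
  ℤ.+ (m ℕ.+ n) / 1                 ≡⟨ cong (_/ 1) (ℤP.pos-+ m n) ⟩
  (ℤ.+ m ℤ.+ ℤ.+ n) / 1              ≡⟨ cong (_/ 1) (sym (cong₂ ℤ._+_ (ℤP.*-identityʳ (ℤ.+ m)) (ℤP.*-identityʳ (ℤ.+ n)))) ⟩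
  ι m + ι n                         ∎
  where open ≡-Reasoning

ι-suc : ∀ k → ι (suc k) ≡ ι k + 1ℚ
ι-suc k = trans (ι-+ 1 k) (ℚP.+-comm 1ℚ (ι k))

ι-* : ∀ m n → ι (m ℕ.* n) ≡ ι m * ι n
ι-* m n = trans (sym (n/1≡ι (m ℕ.* n))) (cong (_/ 1) (ℤP.pos-* m n))

ι-mono-≤ : ∀ {m n} → m ℕ.≤ n → ι m ≤ ι n
ι-mono-≤ {m} {n} m≤n = ℚ.*≤* (subst₂ ℤ._≤_ (sym (ℤP.*-identityʳ (ℤ.+ m))) (sym (ℤP.*-identityʳ (ℤ.+ n))) (ℤ.+≤+ m≤n))

ι-cancel-≤ : ∀ {m n} → ι m ≤ ι n → m ℕ.≤ n
ι-cancel-≤ {m} {n} ιm≤ιn =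
  ℤP.drop‿+≤+ (subst₂ ℤ._≤_ (ℤP.*-identityʳ (ℤ.+ m)) (ℤP.*-identityʳ (ℤ.+ n)) (ℚP.drop-*≤* ιm≤ιn))

0≤ι : ∀ n → 0ℚ ≤ ι n
0≤ι n = ι-mono-≤ ℕ.z≤n

1/ι-positive : ∀ m .{{_ : ℕ.NonZero m}} → ℚ.Positive (1/ ι m)
1/ι-positive (suc m) = _

1/ι-cong : ∀ {m m′} .{{_ : ℕ.NonZero m}} .{{_ : ℕ.NonZero m′}} → m ≡ m′ → 1/ ι m ≡ 1/ ι m′
1/ι-cong refl = refl

ι-ratio-cancel : ∀ a b c .{{_ : ℕ.NonZero b}} .{{_ : ℕ.NonZero c}} →
                 (ι (a ℕ.* c) * (1/ ι (b ℕ.* c)) {{ℕP.m*n≢0 b c}}) ≡ ι a * 1/ ι b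
ι-ratio-cancel a b c = begin
  ι (a ℕ.* c) * 1/ι[bc]                 ≡⟨ cong (_* 1/ι[bc]) (ι-* a c) ⟩
  ι a * ι c * 1/ι[bc]                   ≡⟨ sym (ℚP.*-identityʳ _) ⟩
  ι a * ι c * 1/ι[bc] * 1ℚ              ≡⟨ cong (ι a * ι c * 1/ι[bc] *_) (sym (ℚP.*-inverseʳ (ι b))) ⟩
  ι a * ι c * 1/ι[bc] * (ι b * 1/ ι b)
    ≡⟨ solve 5 (λ a c x b y → a :* c :* x :* (b :* y) := a :* y :* (b :* c :* x)) refl (ι a) (ι c) 1/ι[bc] (ι b) (1/ ι b) ⟩
  ι a * 1/ ι b * (ι b * ι c * 1/ι[bc])  ≡⟨ cong (λ y → ι a * 1/ ι b * (y * 1/ι[bc])) (sym (ι-* b c)) ⟩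
  ι a * 1/ ι b * (ι (b ℕ.* c) * 1/ι[bc]) ≡⟨ cong (ι a * 1/ ι b *_) (ℚP.*-inverseʳ (ι (b ℕ.* c)) {{ℕP.m*n≢0 b c}}) ⟩
  ι a * 1/ ι b * 1ℚ                     ≡⟨ ℚP.*-identityʳ _ ⟩
  ι a * 1/ ι b                          ∎
  where
  open ≡-Reasoning
  1/ι[bc] = (1/ ι (b ℕ.* c)) {{ℕP.m*n≢0 b c}}

*-nonNeg : ∀ {p q} → 0ℚ ≤ p → 0ℚ ≤ q → 0ℚ ≤ p * q
*-nonNeg {p} {q} 0≤p 0≤q = subst (_≤ p * q) (ℚP.*-zeroˡ q) (ℚP.*-monoʳ-≤-nonNeg q {{ℚ.nonNegative 0≤q}} 0≤p)

⌊⌋-yes : ∀ {A : Set} (a? : Dec A) → A → ⌊ a? ⌋ ≡ true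
⌊⌋-yes a? a = trans (isYes≗does a?) (dec-true a? a)

⌊⌋-no : ∀ {A : Set} (a? : Dec A) → ¬ A → ⌊ a? ⌋ ≡ false
⌊⌋-no a? ¬a = trans (isYes≗does a?) (dec-false a? ¬a)

⌊⌋-does≡ : ∀ {A B : Set} (a? : Dec A) (b? : Dec B) → does a? ≡ does b? → ⌊ a? ⌋ ≡ ⌊ b? ⌋
⌊⌋-does≡ a? b? eq = trans (isYes≗does a?) (trans eq (sym (isYes≗does b?)))

if-χ : ∀ b x → (if b then x else 0ℚ) ≡ x * χ b
if-χ true  x = sym (ℚP.*-identityʳ x)
if-χ false x = sym (ℚP.*-zeroʳ x)

χℕ : Bool → ℕ
χℕ true  = 1
χℕ false = 0

χ*-≤ : ∀ b {c} → 0ℚ ≤ c → χ b * c ≤ c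
χ*-≤ true  {c} 0≤c = ℚP.≤-reflexive (ℚP.*-identityˡ c)
χ*-≤ false {c} 0≤c = subst (_≤ c) (sym (ℚP.*-zeroˡ c)) 0≤c

flow-across-≤ : ∀ a b {x c} → 0ℚ ≤ x → x ≤ c → x * (χ a - χ b) ≤ χ (a ∧ not b) * c
flow-across-≤ true  true  {x} {c} 0≤x x≤c = ℚP.≤-reflexive (solve 2 (λ x c → x :* (con 1ℚ :- con 1ℚ) := con 0ℚ :* c) refl x c)
flow-across-≤ false false {x} {c} 0≤x x≤c = ℚP.≤-reflexive (solve 2 (λ x c → x :* (con 0ℚ :- con 0ℚ) := con 0ℚ :* c) refl x c)
flow-across-≤ true  false {x} {c} 0≤x x≤c =
  subst₂ _≤_ (solve 1 (λ x → x := x :* (con 1ℚ :- con 0ℚ)) refl x) (solve 1 (λ c → c := con 1ℚ :* c) refl c) x≤c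
flow-across-≤ false true  {x} {c} 0≤x x≤c =
  subst₂ _≤_ (solve 1 (λ x → :- x := x :* (con 0ℚ :- con 1ℚ)) refl x) (solve 1 (λ c → con 0ℚ := con 0ℚ :* c) refl c)
    (ℚP.neg-antimono-≤ 0≤x)

flow-across-≡ : ∀ a b {x c} → (a ≡ true → b ≡ false → x ≡ c) → (a ≡ false → b ≡ true → x ≡ 0ℚ) →
                x * (χ a - χ b) ≡ χ (a ∧ not b) * c
flow-across-≡ true  true  {x} {c} _ _ = solve 2 (λ x c → x :* (con 1ℚ :- con 1ℚ) := con 0ℚ :* c) refl x c
flow-across-≡ false false {x} {c} _ _ = solve 2 (λ x c → x :* (con 0ℚ :- con 0ℚ) := con 0ℚ :* c) refl x c
flow-across-≡ true  false {x} {c} x≡c _ rewrite x≡c refl refl =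
  solve 1 (λ c → c :* (con 1ℚ :- con 0ℚ) := con 1ℚ :* c) refl c
flow-across-≡ false true  {x} {c} _ x≡0 rewrite x≡0 refl refl =
  solve 1 (λ c → con 0ℚ :* (con 0ℚ :- con 1ℚ) := con 0ℚ :* c) refl c

Σℚ-suc : ∀ {m} (f : Fin (suc m) → ℚ) → Σℚ f ≡ f zero + Σℚ (f ∘ suc)
Σℚ-suc f = cong (λ xs → f zero + List.foldr _+_ 0ℚ xs)
  (trans (ListP.map-tabulate suc f) (sym (ListP.map-tabulate id (f ∘ suc))))

Σℚ≡∑ : ∀ {m} (f : Fin m → ℚ) → Σℚ f ≡ ∑ f
Σℚ≡∑ {zero}  f = refl
Σℚ≡∑ {suc m} f = trans (Σℚ-suc f) (cong (f zero +_) (Σℚ≡∑ (f ∘ suc)))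

Σℚ-cong : ∀ {m} {f g : Fin m → ℚ} → (∀ i → f i ≡ g i) → Σℚ f ≡ Σℚ g
Σℚ-cong {f = f} {g} f≗g = trans (Σℚ≡∑ f) (trans (sum-cong-≗ f≗g) (sym (Σℚ≡∑ g)))

Σℚ-zero : ∀ m → Σℚ {m} (λ _ → 0ℚ) ≡ 0ℚ
Σℚ-zero m = trans (Σℚ≡∑ {m} (λ _ → 0ℚ)) (sum-replicate-zero m)

Σℚ-+ : ∀ {m} (f g : Fin m → ℚ) → Σℚ (λ i → f i + g i) ≡ Σℚ f + Σℚ g
Σℚ-+ f g = trans (Σℚ≡∑ (λ i → f i + g i)) (trans (∑-distrib-+ f g) (sym (cong₂ _+_ (Σℚ≡∑ f) (Σℚ≡∑ g))))

Σℚ-*ʳ : ∀ {m} (f : Fin m → ℚ) c → Σℚ (λ i → f i * c) ≡ Σℚ f * c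
Σℚ-*ʳ f c = trans (Σℚ≡∑ (λ i → f i * c)) (trans (sym (*-distribʳ-sum c f)) (sym (cong (_* c) (Σℚ≡∑ f))))

Σℚ-mono-≤ : ∀ {m} {f g : Fin m → ℚ} → (∀ i → f i ≤ g i) → Σℚ f ≤ Σℚ g
Σℚ-mono-≤ {zero}          f≤g = ℚP.≤-refl
Σℚ-mono-≤ {suc m} {f} {g} f≤g = subst₂ _≤_ (sym (Σℚ-suc f)) (sym (Σℚ-suc g))
  (ℚP.+-mono-≤ (f≤g zero) (Σℚ-mono-≤ (f≤g ∘ suc)))

∑-indicator : ∀ {m} (i : Fin m) c → ∑ (λ j → if ⌊ j FinP.≟ i ⌋ then c else 0ℚ) ≡ c
∑-indicator {suc m} zero    c = trans (cong (c +_) (sum-replicate-zero m)) (ℚP.+-identityʳ c)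
∑-indicator {suc m} (suc i) c = begin
  0ℚ + ∑ (λ j → if ⌊ suc j FinP.≟ suc i ⌋ then c else 0ℚ) ≡⟨ ℚP.+-identityˡ _ ⟩
  ∑ (λ j → if ⌊ suc j FinP.≟ suc i ⌋ then c else 0ℚ)      ≡⟨ sum-cong-≗ (λ j → cong (if_then c else 0ℚ) (⌊⌋-map′ _ _ (j FinP.≟ i))) ⟩
  ∑ (λ j → if ⌊ j FinP.≟ i ⌋ then c else 0ℚ)              ≡⟨ ∑-indicator i c ⟩
  c                                                         ∎
  where open ≡-Reasoning

Σℚ-indicator : ∀ {m} (i : Fin m) c → Σℚ (λ j → if ⌊ j FinP.≟ i ⌋ then c else 0ℚ) ≡ c
Σℚ-indicator i c = trans (Σℚ≡∑ (λ j → if ⌊ j FinP.≟ i ⌋ then c else 0ℚ)) (∑-indicator i c)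

Σℚ-neg : ∀ {m} (f : Fin m → ℚ) → Σℚ (λ i → - f i) ≡ - Σℚ f
Σℚ-neg f = begin
  Σℚ (λ i → - f i)           ≡⟨ Σℚ-cong (λ i → solve 1 (λ x → :- x := x :* con (- 1ℚ)) refl (f i)) ⟩
  Σℚ (λ i → f i * - 1ℚ)      ≡⟨ Σℚ-*ʳ f (- 1ℚ) ⟩
  Σℚ f * - 1ℚ                ≡⟨ solve 1 (λ x → x :* con (- 1ℚ) := :- x) refl (Σℚ f) ⟩
  - Σℚ f                     ∎
  where open ≡-Reasoning

Σℚ-sub : ∀ {m} (f g : Fin m → ℚ) → Σℚ (λ i → f i - g i) ≡ Σℚ f - Σℚ g
Σℚ-sub f g = trans (Σℚ-+ f (λ i → - g i)) (cong (Σℚ f +_) (Σℚ-neg g))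

ΣN : ∀ {m} → (Fin m → ℕ) → ℕ
ΣN {m} h = sum (List.map h (allFin m))

ι-sum : ∀ ns → List.foldr _+_ 0ℚ (List.map ι ns) ≡ ι (sum ns)
ι-sum []       = refl
ι-sum (k ∷ ns) = trans (cong (ι k +_) (ι-sum ns)) (sym (ι-+ k (sum ns)))

Σℚ-ι : ∀ {m} (h : Fin m → ℕ) → Σℚ (λ i → ι (h i)) ≡ ι (ΣN h)
Σℚ-ι {m} h = trans (cong (List.foldr _+_ 0ℚ) (ListP.map-∘ (allFin m))) (ι-sum (List.map h (allFin m)))

count : ∀ {A : Set} → (A → Bool) → List A → ℕ
count p xs = sum (List.map (χℕ ∘ p) xs)

count-cong : ∀ {A : Set} {p q : A → Bool} → (∀ x → p x ≡ q x) → ∀ xs → count p xs ≡ count q xs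
count-cong p≗q xs = cong sum (ListP.map-cong (cong χℕ ∘ p≗q) xs)

count-map : ∀ {A B : Set} (p : B → Bool) (g : A → B) xs → count p (List.map g xs) ≡ count (p ∘ g) xs
count-map p g xs = cong sum (sym (ListP.map-∘ xs))

count-const : ∀ {A : Set} b (xs : List A) → count (λ _ → b) xs ≡ χℕ b ℕ.* length xs
count-const b []       = sym (ℕP.*-zeroʳ (χℕ b))
count-const b (x ∷ xs) = trans (cong (χℕ b ℕ.+_) (count-const b xs)) (sym (ℕP.*-suc (χℕ b) (length xs)))

sum-*ʳ : ∀ {A : Set} (g : A → ℕ) K xs → sum (List.map (λ x → g x ℕ.* K) xs) ≡ sum (List.map g xs) ℕ.* K
sum-*ʳ g K []       = refl
sum-*ʳ g K (x ∷ xs) = trans (cong (g x ℕ.* K ℕ.+_) (sum-*ʳ g K xs)) (sym (ℕP.*-distribʳ-+ K (g x) _))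

sum-concatMap : ∀ {A B : Set} (g : B → ℕ) (h : A → List B) xs →
                sum (List.map g (List.concatMap h xs)) ≡ sum (List.map (λ x → sum (List.map g (h x))) xs)
sum-concatMap g h []       = refl
sum-concatMap g h (x ∷ xs) = begin
  sum (List.map g (h x List.++ List.concatMap h xs))                 ≡⟨ cong sum (ListP.map-++ g (h x) _) ⟩
  sum (List.map g (h x) List.++ List.map g (List.concatMap h xs))    ≡⟨ sum-++ (List.map g (h x)) _ ⟩
  sum (List.map g (h x)) ℕ.+ sum (List.map g (List.concatMap h xs))  ≡⟨ cong (sum (List.map g (h x)) ℕ.+_) (sum-concatMap g h xs) ⟩
  sum (List.map (λ x → sum (List.map g (h x))) (x ∷ xs))             ∎
  where open ≡-Reasoning

count-∧ : ∀ {A : Set} a (q : A → Bool) xs → count (λ x → a ∧ q x) xs ≡ χℕ a ℕ.* count q xs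
count-∧ true  q xs = sym (ℕP.*-identityˡ (count q xs))
count-∧ false q xs = count-const false xs

count-point : ∀ γ β → count (λ x → ⌊ x ℕP.≟ γ ⌋) (List.upTo β) ≡ χℕ ⌊ γ ℕP.<? β ⌋
count-point γ      zero    = refl
count-point zero    (suc β) = cong suc (begin
  count (λ x → ⌊ x ℕP.≟ 0 ⌋) (List.applyUpTo suc β)      ≡⟨ cong (count _) (sym (ListP.map-upTo suc β)) ⟩
  count (λ x → ⌊ x ℕP.≟ 0 ⌋) (List.map suc (List.upTo β)) ≡⟨ count-map _ suc (List.upTo β) ⟩
  count (λ _ → false) (List.upTo β)                       ≡⟨ count-const false (List.upTo β) ⟩
  0                                                       ∎)
  where open ≡-Reasoning
count-point (suc γ) (suc β) = begin
  count (λ x → ⌊ x ℕP.≟ suc γ ⌋) (List.applyUpTo suc β)      ≡⟨ cong (count _) (sym (ListP.map-upTo suc β)) ⟩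
  count (λ x → ⌊ x ℕP.≟ suc γ ⌋) (List.map suc (List.upTo β)) ≡⟨ count-map _ suc (List.upTo β) ⟩
  count (λ x → ⌊ suc x ℕP.≟ suc γ ⌋) (List.upTo β)
    ≡⟨ count-cong (λ x → ⌊⌋-does≡ (suc x ℕP.≟ suc γ) (x ℕP.≟ γ) refl) (List.upTo β) ⟩
  count (λ x → ⌊ x ℕP.≟ γ ⌋) (List.upTo β)                   ≡⟨ count-point γ β ⟩
  χℕ ⌊ γ ℕP.<? β ⌋                                           ≡⟨ cong χℕ (⌊⌋-does≡ (γ ℕP.<? β) (suc γ ℕP.<? suc β) refl) ⟩
  χℕ ⌊ suc γ ℕP.<? suc β ⌋                                   ∎
  where open ≡-Reasoning

sumℚ : List ℚ → ℚ
sumℚ = List.foldr _+_ 0ℚ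

sumℚ-if : ∀ {A : Set} (p : A → Bool) a xs → sumℚ (List.map (λ x → if p x then a else 0ℚ) xs) ≡ ι (count p xs) * a
sumℚ-if p a []       = sym (trans (cong (_* a) ι-0) (ℚP.*-zeroˡ a))
sumℚ-if p a (x ∷ xs) = begin
  (if p x then a else 0ℚ) + sumℚ (List.map (λ x → if p x then a else 0ℚ) xs) ≡⟨ cong₂ _+_ (if-χ (p x) a) (sumℚ-if p a xs) ⟩
  a * χ (p x) + ι (count p xs) * a
    ≡⟨ cong (λ y → y + ι (count p xs) * a) (trans (ℚP.*-comm a _) (cong (_* a) (χ≡ι (p x)))) ⟩
  ι (χℕ (p x)) * a + ι (count p xs) * a                                        ≡⟨ sym (ℚP.*-distribʳ-+ a (ι (χℕ (p x))) (ι (count p xs))) ⟩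
  (ι (χℕ (p x)) + ι (count p xs)) * a                                          ≡⟨ cong (_* a) (sym (ι-+ (χℕ (p x)) _)) ⟩
  ι (count p (x ∷ xs)) * a                                                     ∎
  where
  open ≡-Reasoning
  χ≡ι : ∀ b → χ b ≡ ι (χℕ b)
  χ≡ι true  = refl
  χ≡ι false = sym ι-0

sumℚ-const : ∀ {A : Set} K (xs : List A) → sumℚ (List.map (λ _ → K) xs) ≡ ι (length xs) * K
sumℚ-const K xs = trans (sumℚ-if (λ _ → true) K xs) (cong (λ m → ι m * K) (trans (count-const true xs) (ℕP.*-identityˡ (length xs))))

sumℚ-zero : ∀ {A : Set} (xs : List A) → sumℚ (List.map (λ _ → 0ℚ) xs) ≡ 0ℚ
sumℚ-zero []       = refl
sumℚ-zero (x ∷ xs) = trans (ℚP.+-identityˡ _) (sumℚ-zero xs)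

-- Flows and cuts

module Endpoints {V : Set} (_≟_ : DecidableEquality V) where

  member : List V → V → Bool
  member xs y = any (λ x → ⌊ y ≟ x ⌋) xs

  endpoints : List (Edge V) → List V
  endpoints = List.concatMap (λ e → tail e ∷ head e ∷ [])

  member-tail : ∀ es i → member (endpoints es) (tail (lookup es i)) ≡ true
  member-tail (e ∷ es) zero    rewrite ⌊⌋-yes (tail e ≟ tail e) refl = refl
  member-tail (e ∷ es) (suc i) rewrite member-tail es i | BoolP.∨-zeroʳ ⌊ tail (lookup es i) ≟ head e ⌋ = BoolP.∨-zeroʳ _

  member-head : ∀ es i → member (endpoints es) (head (lookup es i)) ≡ true
  member-head (e ∷ es) zero    rewrite ⌊⌋-yes (head e ≟ head e) refl = BoolP.∨-zeroʳ _
  member-head (e ∷ es) (suc i) rewrite member-head es i | BoolP.∨-zeroʳ ⌊ head (lookup es i) ≟ head e ⌋ = BoolP.∨-zeroʳ _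

  _∩_ : List V → (V → Bool) → V → Bool
  (xs ∩ A) y = member xs y ∧ A y

  ∷-redundant : ∀ {x xs} (A : V → Bool) → A x ≡ false ⊎ member xs x ≡ true → ∀ y → ((x ∷ xs) ∩ A) y ≡ (xs ∩ A) y
  ∷-redundant {x} {xs} A old y with y ≟ x
  ∷-redundant {x} {xs} A (inj₁ Ax≡false) y | yes refl rewrite Ax≡false = sym (BoolP.∧-zeroʳ _)
  ∷-redundant {x} {xs} A (inj₂ x∈xs)     y | yes refl rewrite x∈xs = refl
  ∷-redundant {x} {xs} A old             y | no _ = refl

  ∷-new : ∀ {x xs} (A : V → Bool) → member xs x ≡ false → A x ≡ true →
          ∀ y → χ (((x ∷ xs) ∩ A) y) ≡ χ ((xs ∩ A) y) + χ ⌊ y ≟ x ⌋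
  ∷-new {x} {xs} A x∉xs Ax y with y ≟ x
  ... | no _     = sym (ℚP.+-identityʳ _)
  ... | yes refl rewrite x∉xs | Ax = refl

module FlowTheory {V : Set} (_≟_ : DecidableEquality V) (es : List (Edge V)) (isSrc isSnk : V → Bool) where

  open FlowNetwork _≟_ es isSrc isSnk public

  E : Fin (length es) → Edge V
  E = lookup es

  crossing : (V → Bool) → Fin (length es) → ℚ
  crossing A i = χ (A (tail (E i))) - χ (A (head (E i)))

  netOut : Assignment → (V → Bool) → ℚ
  netOut f A = Σℚ (λ i → f i * crossing A i)

  ｛_｝ : V → V → Bool
  ｛ x ｝ y = ⌊ y ≟ x ⌋

  netOut-congᵉ : ∀ f {A B} → (∀ i → A (tail (E i)) ≡ B (tail (E i))) → (∀ i → A (head (E i)) ≡ B (head (E i))) →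
                 netOut f A ≡ netOut f B
  netOut-congᵉ f tails heads = Σℚ-cong (λ i → cong₂ (λ a b → f i * (χ a - χ b)) (tails i) (heads i))

  netOut-cong : ∀ f {A B} → (∀ x → A x ≡ B x) → netOut f A ≡ netOut f B
  netOut-cong f {A} {B} A≗B = netOut-congᵉ f {A} {B} (A≗B ∘ tail ∘ E) (A≗B ∘ head ∘ E)

  netOut-∅ : ∀ f → netOut f (λ _ → false) ≡ 0ℚ
  netOut-∅ f = trans (Σℚ-cong (λ i → ℚP.*-zeroʳ (f i))) (Σℚ-zero (length es))

  netOut-null : ∀ {f} → (∀ i → f i ≡ 0ℚ) → ∀ A → netOut f A ≡ 0ℚ
  netOut-null {f} f≡0 A = trans (Σℚ-cong (λ i → trans (cong (_* crossing A i) (f≡0 i)) (ℚP.*-zeroˡ (crossing A i)))) (Σℚ-zero (length es))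

  netOut-additive : ∀ f {A B C} → (∀ x → χ (A x) ≡ χ (B x) + χ (C x)) → netOut f A ≡ netOut f B + netOut f C
  netOut-additive f {A} {B} {C} split = trans (Σℚ-cong distribute) (Σℚ-+ (λ i → f i * crossing B i) (λ i → f i * crossing C i))
    where
    distribute : ∀ i → f i * crossing A i ≡ f i * crossing B i + f i * crossing C i
    distribute i rewrite split (tail (E i)) | split (head (E i)) =
      solve 5 (λ x b c b′ c′ → x :* ((b :+ c) :- (b′ :+ c′)) := x :* (b :- b′) :+ x :* (c :- c′)) refl
        (f i) (χ (B (tail (E i)))) (χ (C (tail (E i)))) (χ (B (head (E i)))) (χ (C (head (E i))))

  netOut-singleton : ∀ f x → netOut f ｛ x ｝ ≡ outflow f x - inflow f x
  netOut-singleton f x = begin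
    netOut f ｛ x ｝
      ≡⟨ Σℚ-cong (λ i → solve 3 (λ y a b → y :* (a :- b) := y :* a :- y :* b) refl (f i) (leaves i) (enters i)) ⟩
    Σℚ (λ i → f i * leaves i - f i * enters i)        ≡⟨ Σℚ-sub (λ i → f i * leaves i) (λ i → f i * enters i) ⟩
    Σℚ (λ i → f i * leaves i) - Σℚ (λ i → f i * enters i) ≡⟨ sym (cong₂ _-_ (Σℚ-cong (λ i → if-χ _ (f i))) (Σℚ-cong (λ i → if-χ _ (f i)))) ⟩
    outflow f x - inflow f x                         ∎
    where
    open ≡-Reasoning
    leaves enters : Fin (length es) → ℚ
    leaves i = χ (｛ x ｝ (tail (E i)))
    enters i = χ (｛ x ｝ (head (E i)))

  Inner : (V → Bool) → Set
  Inner A = ∀ x → A x ≡ true → isSrc x ≡ false × isSnk x ≡ false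

  netOut-inner-vertex : ∀ {f} → IsFlow f → ∀ {x} → isSrc x ≡ false → isSnk x ≡ false → netOut f ｛ x ｝ ≡ 0ℚ
  netOut-inner-vertex {f} flow {x} x∉src x∉snk = begin
    netOut f ｛ x ｝           ≡⟨ netOut-singleton f x ⟩
    outflow f x - inflow f x  ≡⟨ cong (λ y → outflow f x - y) (IsFlow.conservation flow x x∉src x∉snk) ⟩
    outflow f x - outflow f x ≡⟨ ℚP.+-inverseʳ (outflow f x) ⟩
    0ℚ                        ∎
    where open ≡-Reasoning

  open Endpoints _≟_

  netOut-inner : ∀ {f} → IsFlow f → ∀ {A} → Inner A → ∀ xs → netOut f (xs ∩ A) ≡ 0ℚ
  netOut-inner {f} flow {A} inner []       = netOut-∅ f
  netOut-inner {f} flow {A} inner (x ∷ xs) with A x in Ax | member xs x in x∈xs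
  ... | false | _     = trans (netOut-cong f {(x ∷ xs) ∩ A} {xs ∩ A} (∷-redundant {x} {xs} A (inj₁ Ax))) (netOut-inner flow inner xs)
  ... | true  | true  = trans (netOut-cong f {(x ∷ xs) ∩ A} {xs ∩ A} (∷-redundant {x} {xs} A (inj₂ x∈xs))) (netOut-inner flow inner xs)
  ... | true  | false = begin
    netOut f ((x ∷ xs) ∩ A)              ≡⟨ netOut-additive f {(x ∷ xs) ∩ A} {xs ∩ A} {｛ x ｝} (∷-new {x} {xs} A x∈xs Ax) ⟩
    netOut f (xs ∩ A) + netOut f ｛ x ｝ ≡⟨ cong₂ _+_ (netOut-inner flow inner xs) (netOut-inner-vertex flow x∉src x∉snk) ⟩
    0ℚ + 0ℚ                              ∎
    where
    open ≡-Reasoning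
    x∉src = proj₁ (inner x Ax)
    x∉snk = proj₂ (inner x Ax)

  record IsCut (S : V → Bool) : Set where
    field
      sources⊆S : ∀ x → isSrc x ≡ true → S x ≡ true
      sinks∩S⊆sources : ∀ x → S x ≡ true → isSnk x ≡ true → isSrc x ≡ true

  cutCapacity : (V → Bool) → ℚ
  cutCapacity S = Σℚ (λ i → χ (S (tail (E i)) ∧ not (S (head (E i)))) * cap (E i))

  -- S∖src may be infinite, but on the edges it agrees with its restriction to the list of endpoints.
  value≡netOut-cut : ∀ {f} → IsFlow f → ∀ {S} → IsCut S → value f ≡ netOut f S
  value≡netOut-cut {f} flow {S} cut = sym (begin
    netOut f S                   ≡⟨ netOut-additive f {S} {isSrc} {S∖src} split ⟩
    value f + netOut f S∖src     ≡⟨ cong (value f +_) (netOut-congᵉ f {S∖src} {endpoints es ∩ S∖src} on-tails on-heads) ⟩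
    value f + netOut f (endpoints es ∩ S∖src) ≡⟨ cong (value f +_) (netOut-inner flow inner (endpoints es)) ⟩
    value f + 0ℚ                 ≡⟨ ℚP.+-identityʳ (value f) ⟩
    value f                      ∎)
    where
    open ≡-Reasoning
    open IsCut cut
    S∖src : V → Bool
    S∖src y = S y ∧ not (isSrc y)
    split : ∀ y → χ (S y) ≡ χ (isSrc y) + χ (S∖src y)
    split y with isSrc y in y∈src
    ... | true  rewrite sources⊆S y y∈src = sym (ℚP.+-identityʳ 1ℚ)
    ... | false with S y
    ...   | true  = refl
    ...   | false = refl
    inner : Inner S∖src
    inner y y∈S∖src with S y in y∈S | isSrc y in y∈src | isSnk y in y∈snk
    ... | true | false | false = refl , refl
    ... | true | false | true  = contradiction (trans (sym (sinks∩S⊆sources y y∈S y∈snk)) y∈src) λ ()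
    on-tails : ∀ i → S∖src (tail (E i)) ≡ (endpoints es ∩ S∖src) (tail (E i))
    on-tails i = sym (cong (_∧ S∖src (tail (E i))) (member-tail es i))
    on-heads : ∀ i → S∖src (head (E i)) ≡ (endpoints es ∩ S∖src) (head (E i))
    on-heads i = sym (cong (_∧ S∖src (head (E i))) (member-head es i))

  weak-duality : ∀ {f} → IsFlow f → ∀ {S} → IsCut S → value f ≤ cutCapacity S
  weak-duality {f} flow {S} cut = subst (_≤ cutCapacity S) (sym (value≡netOut-cut flow cut))
    (Σℚ-mono-≤ (λ i → flow-across-≤ (S (tail (E i))) (S (head (E i))) (IsFlow.nonneg flow i) (IsFlow.capacity flow i)))

  value≡cutCapacity : ∀ {f} → IsFlow f → ∀ {S} → IsCut S →
                      (∀ i → S (tail (E i)) ≡ true → S (head (E i)) ≡ false → f i ≡ cap (E i)) →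
                      (∀ i → S (tail (E i)) ≡ false → S (head (E i)) ≡ true → f i ≡ 0ℚ) →
                      value f ≡ cutCapacity S
  value≡cutCapacity {f} flow {S} cut saturated empty = trans (value≡netOut-cut flow cut)
    (Σℚ-cong (λ i → flow-across-≡ (S (tail (E i))) (S (head (E i))) (saturated i) (empty i)))

  tight⇒maxFlowValue : ∀ {f} → IsFlow f → ∀ {S} → IsCut S → value f ≡ cutCapacity S → IsMaxFlowValue (cutCapacity S)
  tight⇒maxFlowValue {f} flow {S} cut value≡cap = (f , flow , value≡cap) , λ g g-flow → weak-duality g-flow cut

  FlowWithTightCut : Set
  FlowWithTightCut = Σ Assignment λ f → IsFlow f × Σ (V → Bool) λ S → IsCut S × value f ≡ cutCapacity S

  netOut-update : ∀ f f′ i d → f′ i ≡ f i + d → (∀ j → j ≢ i → f′ j ≡ f j) →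
                  ∀ A → netOut f′ A ≡ netOut f A + d * crossing A i
  netOut-update f f′ i d f′i≡ f′j≡ A = begin
    netOut f′ A                                                        ≡⟨ Σℚ-cong split ⟩
    Σℚ (λ j → f j * crossing A j + (if ⌊ j FinP.≟ i ⌋ then d * crossing A i else 0ℚ))
      ≡⟨ Σℚ-+ (λ j → f j * crossing A j) (λ j → if ⌊ j FinP.≟ i ⌋ then d * crossing A i else 0ℚ) ⟩
    netOut f A + Σℚ (λ j → if ⌊ j FinP.≟ i ⌋ then d * crossing A i else 0ℚ) ≡⟨ cong (netOut f A +_) (Σℚ-indicator i _) ⟩
    netOut f A + d * crossing A i                                      ∎
    where
    open ≡-Reasoning
    split : ∀ j → f′ j * crossing A j ≡ f j * crossing A j + (if ⌊ j FinP.≟ i ⌋ then d * crossing A i else 0ℚ)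
    split j with j FinP.≟ i
    ... | yes refl rewrite f′i≡ = ℚP.*-distribʳ-+ (crossing A j) (f j) d
    ... | no j≢i   rewrite f′j≡ j j≢i = sym (ℚP.+-identityʳ _)

-- Maximum flows exist: Ford–Fulkerson

#false : ∀ {m} → (Fin m → Bool) → ℕ
#false {zero}  R = 0
#false {suc m} R = χℕ (not (R zero)) ℕ.+ #false (R ∘ suc)

#false-≤ : ∀ {m} (R : Fin m → Bool) → #false R ℕ.≤ m
#false-≤ {zero}  R = ℕ.z≤n
#false-≤ {suc m} R with R zero
... | true  = ℕP.m≤n⇒m≤1+n (#false-≤ (R ∘ suc))
... | false = ℕ.s≤s (#false-≤ (R ∘ suc))

χℕ-not-antimono : ∀ r r′ → (r ≡ true → r′ ≡ true) → χℕ (not r′) ℕ.≤ χℕ (not r)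
χℕ-not-antimono true  true  _     = ℕ.z≤n
χℕ-not-antimono true  false r⇒r′ = contradiction (r⇒r′ refl) λ ()
χℕ-not-antimono false true  _     = ℕ.z≤n
χℕ-not-antimono false false _     = ℕP.≤-refl

#false-antimono : ∀ {m} {R R′ : Fin m → Bool} → (∀ x → R x ≡ true → R′ x ≡ true) → #false R′ ℕ.≤ #false R
#false-antimono {zero}           R⊆R′ = ℕ.z≤n
#false-antimono {suc m} {R} {R′} R⊆R′ =
  ℕP.+-mono-≤ (χℕ-not-antimono (R zero) (R′ zero) (R⊆R′ zero)) (#false-antimono (R⊆R′ ∘ suc))

#false-strict : ∀ {m} {R R′ : Fin m → Bool} → (∀ x → R x ≡ true → R′ x ≡ true) →
                ∀ b → R b ≡ false → R′ b ≡ true → #false R′ ℕ.< #false R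
#false-strict {suc m} {R} {R′} R⊆R′ zero R0 R′0 rewrite R0 | R′0 = ℕ.s≤s (#false-antimono (R⊆R′ ∘ suc))
#false-strict {suc m} {R} {R′} R⊆R′ (suc b) Rb R′b =
  ℕP.+-mono-≤-< (χℕ-not-antimono (R zero) (R′ zero) (R⊆R′ zero)) (#false-strict (R⊆R′ ∘ suc) b Rb R′b)

module FordFulkerson {n : ℕ} (es : List (Edge (Fin n))) (isSrc isSnk : Fin n → Bool)
                     (δ : ℚ) {{δ>0 : ℚ.Positive δ}} (C : Fin (length es) → ℕ)
                     (cap≡ : ∀ i → cap (lookup es i) ≡ ι (C i) * δ) where

  open FlowTheory FinP._≟_ es isSrc isSnk

  ℕFlow : Set
  ℕFlow = Fin (length es) → ℕ

  flow : ℕFlow → Assignment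
  flow g i = ι (g i) * δ

  _+｛_｝ : (Fin n → Bool) → Fin n → Fin n → Bool
  (R +｛ b ｝) x = ｛ b ｝ x ∨ R x

  +｛｝-⊇ : ∀ R b {x} → R x ≡ true → (R +｛ b ｝) x ≡ true
  +｛｝-⊇ R b {x} x∈R rewrite x∈R = BoolP.∨-zeroʳ (｛ b ｝ x)

  +｛｝-∋ : ∀ R b → (R +｛ b ｝) b ≡ true
  +｛｝-∋ R b rewrite ⌊⌋-yes (b FinP.≟ b) refl = refl

  +｛｝-∌ : ∀ R b {x} → (R +｛ b ｝) x ≡ false → R x ≡ false
  +｛｝-∌ R b {x} = BoolP.∨-conicalʳ (｛ b ｝ x) (R x)

  -- Arc g i a b: one unit can be pushed from a to b along edge i; a backward arc cancels flow.
  data Arc (g : ℕFlow) : Fin (length es) → Fin n → Fin n → Set where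
    forward  : ∀ {i} → g i ℕ.< C i → Arc g i (tail (E i)) (head (E i))
    backward : ∀ {i} → 0 ℕ.< g i → Arc g i (head (E i)) (tail (E i))

  arc-inside : ∀ {g i a b} → Arc g i a b → ∀ (R : Fin n → Bool) → R a ≡ true → R b ≡ true →
               ∀ j → R (tail (E j)) ≡ false ⊎ R (head (E j)) ≡ false → j ≢ i
  arc-inside (forward _)  R a∈R b∈R j (inj₁ t∉R) refl = contradiction (trans (sym a∈R) t∉R) λ ()
  arc-inside (forward _)  R a∈R b∈R j (inj₂ h∉R) refl = contradiction (trans (sym b∈R) h∉R) λ ()
  arc-inside (backward _) R a∈R b∈R j (inj₁ t∉R) refl = contradiction (trans (sym b∈R) t∉R) λ ()
  arc-inside (backward _) R a∈R b∈R j (inj₂ h∉R) refl = contradiction (trans (sym a∈R) h∉R) λ ()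

  arc-target : ∀ {g i a b} → Arc g i a b → ∀ (R : Fin n → Bool) → R b ≡ false →
               R (tail (E i)) ≡ false ⊎ R (head (E i)) ≡ false
  arc-target (forward _)  R b∉R = inj₂ b∉R
  arc-target (backward _) R b∉R = inj₁ b∉R

  push : ∀ {g i a b} → Arc g i a b → ℕFlow → ℕFlow
  push {i = i} (forward _)  h = updateAt h i suc
  push {i = i} (backward _) h = updateAt h i ℕ.pred

  push-elsewhere : ∀ {g i a b} (arc : Arc g i a b) h j → j ≢ i → push arc h j ≡ h j
  push-elsewhere {i = i} (forward _)  h j j≢i = updateAt-minimal j i h j≢i
  push-elsewhere {i = i} (backward _) h j j≢i = updateAt-minimal j i h j≢i

  push-bounded : ∀ {g i a b} (arc : Arc g i a b) h → h i ≡ g i → (∀ j → h j ℕ.≤ C j) → ∀ j → push arc h j ℕ.≤ C j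
  push-bounded {i = i} arc h hi≡gi h≤C j with j FinP.≟ i
  ... | no j≢i = subst (ℕ._≤ C j) (sym (push-elsewhere arc h j j≢i)) (h≤C j)
  push-bounded {i = i} (forward gi<Ci) h hi≡gi h≤C j | yes refl =
    subst (ℕ._≤ C j) (sym (trans (updateAt-updates j h) (cong suc hi≡gi))) gi<Ci
  push-bounded {i = i} (backward _)    h hi≡gi h≤C j | yes refl =
    subst (ℕ._≤ C j) (sym (updateAt-updates j h)) (ℕP.≤-trans ℕP.pred[n]≤n (h≤C j))

  ι-suc*δ : ∀ k → ι (suc k) * δ ≡ ι k * δ + δ
  ι-suc*δ k = trans (cong (_* δ) (ι-suc k)) (solve 2 (λ x d → (x :+ con 1ℚ) :* d := x :* d :+ d) refl (ι k) δ)

  ι-pred*δ : ∀ m → 0 ℕ.< m → ι (ℕ.pred m) * δ ≡ ι m * δ + - δ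
  ι-pred*δ (suc k) _ = trans (solve 2 (λ x d → x := x :+ d :+ :- d) refl (ι k * δ) δ) (cong (_+ - δ) (sym (ι-suc*δ k)))

  netOut-updateAt : ∀ h i (φ : ℕ → ℕ) d → ι (φ (h i)) * δ ≡ ι (h i) * δ + d →
                    ∀ A → netOut (flow (updateAt h i φ)) A ≡ netOut (flow h) A + d * crossing A i
  netOut-updateAt h i φ d step = netOut-update (flow h) (flow (updateAt h i φ)) i d
    (trans (cong (λ k → ι k * δ) (updateAt-updates i h)) step)
    (λ j j≢i → cong (λ k → ι k * δ) (updateAt-minimal j i h j≢i))

  push-shift : ∀ {g i a b} (arc : Arc g i a b) h → h i ≡ g i → ∀ A →
               netOut (flow (push arc h)) A ≡ netOut (flow h) A + (χ (A a) - χ (A b)) * δ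
  push-shift {i = i} (forward _) h _ A =
    trans (netOut-updateAt h i suc δ (ι-suc*δ (h i)) A) (cong (netOut (flow h) A +_) (ℚP.*-comm δ (crossing A i)))
  push-shift {i = i} (backward 0<gi) h hi≡gi A =
    trans (netOut-updateAt h i ℕ.pred (- δ) (ι-pred*δ (h i) (subst (0 ℕ.<_) (sym hi≡gi) 0<gi)) A)
          (cong (netOut (flow h) A +_) (solve 3 (λ d t u → :- d :* (t :- u) := (u :- t) :* d) refl δ (χ (A (tail (E i)))) (χ (A (head (E i))))))

  data Tree (g : ℕFlow) : (Fin n → Bool) → Set where
    roots : Tree g isSrc
    grow  : ∀ {R i a b} → Tree g R → R a ≡ true → R b ≡ false → Arc g i a b → Tree g (R +｛ b ｝)

  sources⊆tree : ∀ {g R} → Tree g R → ∀ x → isSrc x ≡ true → R x ≡ true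
  sources⊆tree roots                         x x∈src = x∈src
  sources⊆tree (grow {R} {b = b} tree _ _ _) x x∈src = +｛｝-⊇ R b (sources⊆tree tree x x∈src)

  -- The effect of pushing δ along the tree path from some source to x.
  record Augmentation (g : ℕFlow) (R : Fin n → Bool) (x : Fin n) : Set where
    field
      augmented  : ℕFlow
      source     : Fin n
      source∈src : isSrc source ≡ true
      unchanged  : ∀ j → R (tail (E j)) ≡ false ⊎ R (head (E j)) ≡ false → augmented j ≡ g j
      bounded    : ∀ j → augmented j ℕ.≤ C j
      shift      : ∀ A → netOut (flow augmented) A ≡ netOut (flow g) A + (χ (A source) - χ (A x)) * δ

  augmentation-⊆ : ∀ {g R R′ x} → (∀ {y} → R′ y ≡ false → R y ≡ false) → Augmentation g R x → Augmentation g R′ x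
  augmentation-⊆ R⊆R′ aug = record
    { augmented  = augmented
    ; source     = source
    ; source∈src = source∈src
    ; unchanged  = λ j outside → unchanged j (Data.Sum.map R⊆R′ R⊆R′ outside)
    ; bounded    = bounded
    ; shift      = shift
    }
    where open Augmentation aug

  augmentation-grow : ∀ {g R i a b} → Arc g i a b → R a ≡ true → R b ≡ false → Augmentation g R a → Augmentation g (R +｛ b ｝) b
  augmentation-grow {g} {R} {i} {a} {b} arc a∈R b∉R aug = record
    { augmented  = push arc augmented
    ; source     = source
    ; source∈src = source∈src
    ; unchanged  = λ j outside →
        trans (push-elsewhere arc augmented j (arc-inside arc (R +｛ b ｝) (+｛｝-⊇ R b a∈R) (+｛｝-∋ R b) j outside))
              (unchanged j (Data.Sum.map (+｛｝-∌ R b) (+｛｝-∌ R b) outside))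
    ; bounded    = push-bounded arc augmented i-unchanged bounded
    ; shift      = shift′
    }
    where
    open Augmentation aug
    i-unchanged : augmented i ≡ g i
    i-unchanged = unchanged i (arc-target arc R b∉R)
    shift′ : ∀ A → netOut (flow (push arc augmented)) A ≡ netOut (flow g) A + (χ (A source) - χ (A b)) * δ
    shift′ A = begin
      netOut (flow (push arc augmented)) A                                       ≡⟨ push-shift arc augmented i-unchanged A ⟩
      netOut (flow augmented) A + (χ (A a) - χ (A b)) * δ                        ≡⟨ cong (_+ (χ (A a) - χ (A b)) * δ) (shift A) ⟩
      netOut (flow g) A + (χ (A source) - χ (A a)) * δ + (χ (A a) - χ (A b)) * δ
        ≡⟨ solve 5 (λ y s a b d → y :+ (s :- a) :* d :+ (a :- b) :* d := y :+ (s :- b) :* d) refl (netOut (flow g) A) (χ (A source)) (χ (A a)) (χ (A b)) δ ⟩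
      netOut (flow g) A + (χ (A source) - χ (A b)) * δ                           ∎
      where open ≡-Reasoning

  augment : ∀ {g R} → (∀ j → g j ℕ.≤ C j) → Tree g R → ∀ x → R x ≡ true → Augmentation g R x
  augment {g} g≤C roots x x∈src = record
    { augmented  = g
    ; source     = x
    ; source∈src = x∈src
    ; unchanged  = λ _ _ → refl
    ; bounded    = g≤C
    ; shift      = λ A → solve 3 (λ y c d → y := y :+ (c :- c) :* d) refl (netOut (flow g) A) (χ (A x)) δ
    }
  augment g≤C (grow {R} {i} {a} {b} tree a∈R b∉R arc) x x∈R′ with x FinP.≟ b
  ... | no _     = augmentation-⊆ (+｛｝-∌ R b) (augment g≤C tree x x∈R′)
  ... | yes refl = augmentation-grow arc a∈R b∉R (augment g≤C tree a a∈R)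

  Exit : ℕFlow → (Fin n → Bool) → Fin (length es) → Set
  Exit g R i = (R (tail (E i)) ≡ true × R (head (E i)) ≡ false × g i ℕ.< C i)
             ⊎ (R (head (E i)) ≡ true × R (tail (E i)) ≡ false × 0 ℕ.< g i)

  exit? : ∀ g R i → Dec (Exit g R i)
  exit? g R i = (R (tail (E i)) BoolP.≟ true ×-dec R (head (E i)) BoolP.≟ false ×-dec g i ℕP.<? C i)
          ⊎-dec (R (head (E i)) BoolP.≟ true ×-dec R (tail (E i)) BoolP.≟ false ×-dec 0 ℕP.<? g i)

  record Closure (g : ℕFlow) : Set where
    field
      reached : Fin n → Bool
      tree    : Tree g reached
      closed  : ∀ i → ¬ Exit g reached i

  close : ∀ {g R} (fuel : ℕ) → Tree g R → #false R ℕ.≤ fuel → Closure g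
  close-grown : ∀ {g R b} (fuel : ℕ) → Tree g (R +｛ b ｝) → R b ≡ false → #false R ℕ.≤ fuel → Closure g

  close {g} {R} fuel tree #R≤fuel with FinP.any? (exit? g R)
  ... | no ¬exit = record { reached = R ; tree = tree ; closed = λ i exit → ¬exit (i , exit) }
  ... | yes (i , inj₁ (t∈R , h∉R , gi<Ci)) = close-grown fuel (grow tree t∈R h∉R (forward gi<Ci)) h∉R #R≤fuel
  ... | yes (i , inj₂ (h∈R , t∉R , 0<gi))  = close-grown fuel (grow tree h∈R t∉R (backward 0<gi)) t∉R #R≤fuel

  close-grown {R = R} {b} fuel tree′ b∉R #R≤fuel
    with fuel | ℕP.<-≤-trans (#false-strict (λ _ → +｛｝-⊇ R b) b b∉R (+｛｝-∋ R b)) #R≤fuel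
  ... | suc fuel′ | #R′<fuel = close fuel′ tree′ (ℕP.≤-pred #R′<fuel)

  record Feasible (g : ℕFlow) : Set where
    field
      bounded   : ∀ j → g j ℕ.≤ C j
      conserved : ∀ z → isSrc z ≡ false → isSnk z ≡ false → netOut (flow g) ｛ z ｝ ≡ 0ℚ

  ι*δ-mono-≤ : ∀ {k l} → k ℕ.≤ l → ι k * δ ≤ ι l * δ
  ι*δ-mono-≤ k≤l = ℚP.*-monoʳ-≤-nonNeg δ {{ℚP.pos⇒nonNeg δ}} (ι-mono-≤ k≤l)

  ι0*δ≡0 : ι 0 * δ ≡ 0ℚ
  ι0*δ≡0 = trans (cong (_* δ) ι-0) (ℚP.*-zeroˡ δ)

  0≤ι*δ : ∀ k → 0ℚ ≤ ι k * δ
  0≤ι*δ k = subst (_≤ ι k * δ) ι0*δ≡0 (ι*δ-mono-≤ ℕ.z≤n)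

  feasible⇒flow : ∀ {g} → Feasible g → IsFlow (flow g)
  feasible⇒flow {g} feasible = record
    { nonneg       = λ i → 0≤ι*δ (g i)
    ; capacity     = λ i → subst (flow g i ≤_) (sym (cap≡ i)) (ι*δ-mono-≤ (bounded i))
    ; conservation = λ x x∉src x∉snk → sym (x∙y⁻¹≈ε⇒x≈y _ _ (trans (sym (netOut-singleton (flow g) x)) (conserved x x∉src x∉snk)))
    }
    where open Feasible feasible

  value-bound : ∀ {g} → Feasible g → value (flow g) ≤ ι (ΣN C) * δ
  value-bound {g} feasible = begin
    value (flow g)               ≤⟨ weak-duality (feasible⇒flow feasible) {isSrc} sources-cut ⟩
    cutCapacity isSrc
      ≤⟨ Σℚ-mono-≤ (λ i → χ*-≤ (isSrc (tail (E i)) ∧ not (isSrc (head (E i)))) (subst (0ℚ ≤_) (sym (cap≡ i)) (0≤ι*δ (C i)))) ⟩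
    Σℚ (λ i → cap (E i))         ≡⟨ Σℚ-cong cap≡ ⟩
    Σℚ (λ i → ι (C i) * δ)       ≡⟨ Σℚ-*ʳ (λ i → ι (C i)) δ ⟩
    Σℚ (λ i → ι (C i)) * δ       ≡⟨ cong (_* δ) (Σℚ-ι C) ⟩
    ι (ΣN C) * δ                 ∎
    where
    open ℚP.≤-Reasoning
    sources-cut : IsCut isSrc
    sources-cut = record { sources⊆S = λ _ x∈src → x∈src ; sinks∩S⊆sources = λ _ x∈src _ → x∈src }

  tight-closure : ∀ {g} → Feasible g → (cl : Closure g) →
                  (∀ x → Closure.reached cl x ≡ true → isSnk x ≡ true → isSrc x ≡ true) → FlowWithTightCut
  tight-closure {g} feasible cl sinks-unreached =
    flow g , isFlow , reached , cut , value≡cutCapacity isFlow cut saturated empty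
    where
    open Closure cl
    open Feasible feasible
    isFlow = feasible⇒flow feasible
    cut : IsCut reached
    cut = record { sources⊆S = sources⊆tree tree ; sinks∩S⊆sources = sinks-unreached }
    saturated : ∀ i → reached (tail (E i)) ≡ true → reached (head (E i)) ≡ false → flow g i ≡ cap (E i)
    saturated i t∈R h∉R = trans (cong (λ k → ι k * δ) gi≡Ci) (sym (cap≡ i))
      where
      gi≡Ci = ℕP.≤-antisym (bounded i) (ℕP.≮⇒≥ (λ gi<Ci → closed i (inj₁ (t∈R , h∉R , gi<Ci))))
    empty : ∀ i → reached (tail (E i)) ≡ false → reached (head (E i)) ≡ true → flow g i ≡ 0ℚ
    empty i t∉R h∈R = trans (cong (λ k → ι k * δ) gi≡0) ι0*δ≡0
      where
      gi≡0 = ℕP.n≤0⇒n≡0 (ℕP.≮⇒≥ (λ 0<gi → closed i (inj₂ (h∈R , t∉R , 0<gi))))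

  augment-feasible : ∀ {g R x} → Feasible g → (aug : Augmentation g R x) → isSnk x ≡ true → isSrc x ≡ false →
                     Feasible (Augmentation.augmented aug) × value (flow (Augmentation.augmented aug)) ≡ value (flow g) + δ
  augment-feasible {g} {R} {x} feasible aug x∈snk x∉src = record { bounded = bounded ; conserved = conserved′ } , value′
    where
    open Augmentation aug
    conserved′ : ∀ z → isSrc z ≡ false → isSnk z ≡ false → netOut (flow augmented) ｛ z ｝ ≡ 0ℚ
    conserved′ z z∉src z∉snk = begin
      netOut (flow augmented) ｛ z ｝                                           ≡⟨ shift ｛ z ｝ ⟩
      netOut (flow g) ｛ z ｝ + (χ (｛ z ｝ source) - χ (｛ z ｝ x)) * δ
        ≡⟨ cong₂ (λ s y → netOut (flow g) ｛ z ｝ + (χ s - χ y) * δ) (⌊⌋-no (source FinP.≟ z) source≢z) (⌊⌋-no (x FinP.≟ z) x≢z) ⟩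
      netOut (flow g) ｛ z ｝ + (0ℚ - 0ℚ) * δ
        ≡⟨ cong₂ (λ y d → y + d) (Feasible.conserved feasible z z∉src z∉snk) (ℚP.*-zeroˡ δ) ⟩
      0ℚ + 0ℚ                                                                  ∎
      where
      open ≡-Reasoning
      source≢z : source ≢ z
      source≢z refl = contradiction (trans (sym source∈src) z∉src) λ ()
      x≢z : x ≢ z
      x≢z refl = contradiction (trans (sym x∈snk) z∉snk) λ ()
    value′ : value (flow augmented) ≡ value (flow g) + δ
    value′ = begin
      value (flow augmented)                                         ≡⟨ shift isSrc ⟩
      value (flow g) + (χ (isSrc source) - χ (isSrc x)) * δ          ≡⟨ cong₂ (λ s y → value (flow g) + (χ s - χ y) * δ) source∈src x∉src ⟩
      value (flow g) + (1ℚ - 0ℚ) * δ                                 ≡⟨ cong (value (flow g) +_) (ℚP.*-identityˡ δ) ⟩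
      value (flow g) + δ                                             ∎
      where open ≡-Reasoning

  phase : ∀ {g} → Feasible g → Closure g → FlowWithTightCut ⊎ Σ ℕFlow λ g′ → Feasible g′ × value (flow g′) ≡ value (flow g) + δ
  phase feasible cl with FinP.any? (λ x → (Closure.reached cl x BoolP.≟ true) ×-dec (isSnk x BoolP.≟ true) ×-dec (isSrc x BoolP.≟ false))
  ... | yes (x , x∈R , x∈snk , x∉src) =
    inj₂ (_ , augment-feasible feasible (augment (Feasible.bounded feasible) (Closure.tree cl) x x∈R) x∈snk x∉src)
  ... | no none = inj₁ (tight-closure feasible cl sinks⊆sources)
    where
    sinks⊆sources : ∀ x → Closure.reached cl x ≡ true → isSnk x ≡ true → isSrc x ≡ true
    sinks⊆sources x x∈R x∈snk with isSrc x in x∈src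
    ... | true  = refl
    ... | false = contradiction (x , x∈R , x∈snk , x∈src) none

  -- There are fewer than k augmentations left, since the value v * δ never exceeds ΣN C * δ.
  phases : ∀ k {g} v → Feasible g → value (flow g) ≡ ι v * δ → ΣN C ℕ.< k ℕ.+ v → FlowWithTightCut
  phases zero    v feasible value≡vδ ΣC<v = contradiction ΣC<v (ℕP.≤⇒≯ v≤ΣC)
    where
    v≤ΣC = ι-cancel-≤ (ℚP.*-cancelʳ-≤-pos δ (subst (_≤ ι (ΣN C) * δ) value≡vδ (value-bound feasible)))
  phases (suc k) v feasible value≡vδ ΣC<1+k+v with phase feasible (close n roots (#false-≤ isSrc))
  ... | inj₁ tight                  = tight
  ... | inj₂ (g′ , feasible′ , value′) =
    phases k (suc v) feasible′ value′≡ (subst (ΣN C ℕ.<_) (sym (ℕP.+-suc k v)) ΣC<1+k+v)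
    where
    value′≡ : value (flow g′) ≡ ι (suc v) * δ
    value′≡ = trans value′ (trans (cong (_+ δ) value≡vδ) (sym (ι-suc*δ v)))

  flow-with-tight-cut : FlowWithTightCut
  flow-with-tight-cut = phases (suc (ΣN C)) 0 zero-feasible zero-value (subst (ΣN C ℕ.<_) (sym (ℕP.+-identityʳ _)) (ℕP.n<1+n _))
    where
    zero-flow : ∀ i → flow (λ _ → 0) i ≡ 0ℚ
    zero-flow i = ι0*δ≡0
    zero-feasible : Feasible (λ _ → 0)
    zero-feasible = record { bounded = λ _ → ℕ.z≤n ; conserved = λ z _ _ → netOut-null zero-flow ｛ z ｝ }
    zero-value : value (flow (λ _ → 0)) ≡ ι 0 * δ
    zero-value = trans (netOut-null zero-flow isSrc) (sym ι0*δ≡0)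

denominator-clears : ∀ q → q * ι (ℚ.↧ₙ q) ≡ ℚ.↥ q / 1
denominator-clears (mkℚ a d-1 _) = ℚP.fromℚᵘ-cong {ℚᵘ.mkℚᵘ (a ℤ.* ℤ.+ suc d-1) (d-1 ℕ.* 1)} {ℚᵘ.mkℚᵘ a 0}
  (ℚᵘ.*≡* (trans (ℤP.*-identityʳ _) (cong (λ k → a ℤ.* ℤ.+ suc k) (sym (ℕP.*-identityʳ d-1)))))

nonNeg-denominator-clears : ∀ q → 0ℚ ≤ q → q * ι (ℚ.↧ₙ q) ≡ ι ℤ.∣ ℚ.↥ q ∣
nonNeg-denominator-clears q@(mkℚ _ _ _) 0≤q = begin
  q * ι (ℚ.↧ₙ q)       ≡⟨ denominator-clears q ⟩
  ℚ.↥ q / 1            ≡⟨ cong (_/ 1) (sym (ℤP.0≤i⇒+∣i∣≡i (ℤP.nonNegative⁻¹ (ℚ.↥ q) {{ℚ.nonNegative 0≤q}}))) ⟩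
  ℤ.+ ℤ.∣ ℚ.↥ q ∣ / 1  ≡⟨ n/1≡ι _ ⟩
  ι ℤ.∣ ℚ.↥ q ∣        ∎
  where open ≡-Reasoning

-- Multiples of 1/D for D the product of all denominators.
commensurable : ∀ {A : Set} (w : A → ℚ) (xs : List A) → All (λ x → 0ℚ ≤ w x) xs →
                Σ ℚ λ δ → ℚ.Positive δ × Σ (Fin (length xs) → ℕ) λ C → ∀ i → w (lookup xs i) ≡ ι (C i) * δ
commensurable w xs 0≤w = 1/ ι D , 1/ι-positive D , C , w≡Cδ
  where
  D : ℕ
  D = product (List.map (ℚ.↧ₙ_ ∘ w) xs)
  instance
    D≢0 : ℕ.NonZero D
    D≢0 = product≢0 (AllP.map⁺ (All.universal (λ _ → _) xs))
  cofactor : ∀ i → ℚ.↧ₙ w (lookup xs i) ∣ D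
  cofactor i = ∈⇒∣product (∈-map⁺ (ℚ.↧ₙ_ ∘ w) (∈-lookup {xs = xs} i))
  C : Fin (length xs) → ℕ
  C i = ℤ.∣ ℚ.↥ w (lookup xs i) ∣ ℕ.* quotient (cofactor i)
  w≡Cδ : ∀ i → w (lookup xs i) ≡ ι (C i) * 1/ ι D
  w≡Cδ i = begin
    q                                ≡⟨ solve 1 (λ q → q := q :* con 1ℚ) refl q ⟩
    q * 1ℚ                           ≡⟨ cong (q *_) (sym (ℚP.*-inverseʳ (ι D))) ⟩
    q * (ι D * 1/ ι D)               ≡⟨ cong (λ k → q * (ι k * 1/ ι D)) D≡r*d ⟩
    q * (ι (r ℕ.* d) * 1/ ι D)       ≡⟨ cong (λ x → q * (x * 1/ ι D)) (ι-* r d) ⟩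
    q * (ι r * ι d * 1/ ι D)         ≡⟨ solve 4 (λ q r d u → q :* (r :* d :* u) := q :* d :* r :* u) refl q (ι r) (ι d) (1/ ι D) ⟩
    q * ι d * ι r * 1/ ι D           ≡⟨ cong (λ x → x * ι r * 1/ ι D) (nonNeg-denominator-clears q (All.lookup 0≤w (∈-lookup i))) ⟩
    ι ℤ.∣ ℚ.↥ q ∣ * ι r * 1/ ι D     ≡⟨ cong (_* 1/ ι D) (sym (ι-* ℤ.∣ ℚ.↥ q ∣ r)) ⟩
    ι (C i) * 1/ ι D                 ∎
    where
    open ≡-Reasoning
    q = w (lookup xs i)
    d = ℚ.↧ₙ q
    r = quotient (cofactor i)
    D≡r*d : D ≡ r ℕ.* d
    D≡r*d = _∣_.equality (cofactor i)

max-flow-min-cut : ∀ {n} (es : List (Edge (Fin n))) (isSrc isSnk : Fin n → Bool) → All (λ e → 0ℚ ≤ cap e) es →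
                   FlowTheory.FlowWithTightCut FinP._≟_ es isSrc isSnk
max-flow-min-cut es isSrc isSnk 0≤cap =
  let δ , δ>0 , C , cap≡Cδ = commensurable cap es 0≤cap
  in  FordFulkerson.flow-with-tight-cut es isSrc isSnk δ {{δ>0}} C cap≡Cδ

-- Lattice points of boxes

product-allFin : ∀ {m} (g : Fin m → ℕ) → product (List.map g (allFin m)) ≡ ∏ g
product-allFin {zero}  g = refl
product-allFin {suc m} g = cong (g zero ℕ.*_)
  (trans (cong product (trans (ListP.map-tabulate suc g) (sym (ListP.map-tabulate id (g ∘ suc))))) (product-allFin (g ∘ suc)))

∏-nonZero : ∀ {m} (g : Fin m → ℕ) → (∀ i → ℕ.NonZero (g i)) → ℕ.NonZero (∏ g)
∏-nonZero {zero}  g g≢0 = _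
∏-nonZero {suc m} g g≢0 = ℕP.m*n≢0 (g zero) (∏ (g ∘ suc)) {{g≢0 zero}} {{∏-nonZero (g ∘ suc) (g≢0 ∘ suc)}}

_≟ⱽ_ : ∀ {m} → DecidableEquality (Vec ℕ m)
_≟ⱽ_ = VecP.≡-dec ℕP._≟_

≟ⱽ-∷ : ∀ {m} x y (xs ys : Vec ℕ m) → ⌊ (x ∷ xs) ≟ⱽ (y ∷ ys) ⌋ ≡ ⌊ x ℕP.≟ y ⌋ ∧ ⌊ xs ≟ⱽ ys ⌋
≟ⱽ-∷ x y xs ys = trans (isYes≗does ((x ∷ xs) ≟ⱽ (y ∷ ys)))
  (sym (cong₂ _∧_ (isYes≗does (x ℕP.≟ y)) (isYes≗does (xs ≟ⱽ ys))))

allCoords : ∀ {m} → (Fin m → ℕ → Bool) → Vec ℕ m → Bool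
allCoords p []      = true
allCoords p (x ∷ c) = p zero x ∧ allCoords (p ∘ suc) c

mask : ∀ {m} → (Fin m → Bool) → Vec ℕ m → Vec ℕ m
mask μ c = Vec.tabulate (λ i → if μ i then Vec.lookup c i else 0)

mask-≟ : ∀ {m} (μ : Fin m → Bool) c c₀ →
         ⌊ mask μ c ≟ⱽ c₀ ⌋ ≡ allCoords (λ i x → ⌊ (if μ i then x else 0) ℕP.≟ Vec.lookup c₀ i ⌋) c
mask-≟ μ []      []       = refl
mask-≟ μ (x ∷ c) (γ ∷ c₀) = trans (≟ⱽ-∷ _ γ (mask (μ ∘ suc) c) c₀) (cong (_ ∧_) (mask-≟ (μ ∘ suc) c c₀))

admissible : Bool → ℕ → ℕ → ℕ
admissible μ β γ = if μ then χℕ ⌊ γ ℕP.<? β ⌋ else χℕ ⌊ 0 ℕP.≟ γ ⌋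

free : Bool → ℕ → ℕ
free μ β = if μ then 1 else β

coordinate-count : ∀ μ β γ → count (λ x → ⌊ (if μ then x else 0) ℕP.≟ γ ⌋) (List.upTo β) ≡ admissible μ β γ ℕ.* free μ β
coordinate-count true  β γ = trans (count-point γ β) (sym (ℕP.*-identityʳ _))
coordinate-count false β γ = trans (count-const ⌊ 0 ℕP.≟ γ ⌋ (List.upTo β)) (cong (χℕ ⌊ 0 ℕP.≟ γ ⌋ ℕ.*_) (ListP.length-upTo β))

module Boxes (𝒢 : ParamGraphTemplate) where

  box-count : ∀ {m} (β : Fin m → ℕ) (p : Fin m → ℕ → Bool) →
              count (allCoords p) (allBelow 𝒢 (Vec.tabulate β)) ≡ ∏ (λ i → count (p i) (List.upTo (β i)))
  box-count {zero}  β p = refl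
  box-count {suc m} β p = begin
    count (allCoords p) (List.concatMap (λ x → List.map (x ∷_) B) (List.upTo (β zero)))
      ≡⟨ sum-concatMap (χℕ ∘ allCoords p) (λ x → List.map (x ∷_) B) (List.upTo (β zero)) ⟩
    sum (List.map (λ x → count (allCoords p) (List.map (x ∷_) B)) (List.upTo (β zero)))
      ≡⟨ cong sum (ListP.map-cong (λ x → trans (count-map (allCoords p) (x ∷_) B) (count-∧ (p zero x) (allCoords (p ∘ suc)) B)) (List.upTo (β zero))) ⟩
    sum (List.map (λ x → χℕ (p zero x) ℕ.* count (allCoords (p ∘ suc)) B) (List.upTo (β zero)))
      ≡⟨ sum-*ʳ (χℕ ∘ p zero) _ (List.upTo (β zero)) ⟩
    count (p zero) (List.upTo (β zero)) ℕ.* count (allCoords (p ∘ suc)) B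
      ≡⟨ cong (count (p zero) (List.upTo (β zero)) ℕ.*_) (box-count (β ∘ suc) (p ∘ suc)) ⟩
    ∏ (λ i → count (p i) (List.upTo (β i)))
      ∎
    where
    open ≡-Reasoning
    B = allBelow 𝒢 (Vec.tabulate (β ∘ suc))

  fibre-count : ∀ {m} (μ : Fin m → Bool) (β : Fin m → ℕ) c₀ →
                count (λ c → ⌊ mask μ c ≟ⱽ c₀ ⌋) (allBelow 𝒢 (Vec.tabulate β))
                ≡ ∏ (λ i → admissible (μ i) (β i) (Vec.lookup c₀ i)) ℕ.* ∏ (λ i → free (μ i) (β i))
  fibre-count μ β c₀ = begin
    count (λ c → ⌊ mask μ c ≟ⱽ c₀ ⌋) (allBelow 𝒢 (Vec.tabulate β))  ≡⟨ count-cong (λ c → mask-≟ μ c c₀) (allBelow 𝒢 (Vec.tabulate β)) ⟩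
    count (allCoords p) (allBelow 𝒢 (Vec.tabulate β))                ≡⟨ box-count β p ⟩
    ∏ (λ i → count (p i) (List.upTo (β i)))                          ≡⟨ ∏-cong-≗ (λ i → coordinate-count (μ i) (β i) (Vec.lookup c₀ i)) ⟩
    ∏ (λ i → admissible (μ i) (β i) (Vec.lookup c₀ i) ℕ.* free (μ i) (β i))
      ≡⟨ ∏-distrib-* (λ i → admissible (μ i) (β i) (Vec.lookup c₀ i)) (λ i → free (μ i) (β i)) ⟩
    ∏ (λ i → admissible (μ i) (β i) (Vec.lookup c₀ i)) ℕ.* ∏ (λ i → free (μ i) (β i)) ∎
    where
    open ≡-Reasoning
    p : _ → ℕ → Bool
    p i x = ⌊ (if μ i then x else 0) ℕP.≟ Vec.lookup c₀ i ⌋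

  allCoords-true : ∀ {m} (c : Vec ℕ m) → allCoords (λ _ _ → true) c ≡ true
  allCoords-true []      = refl
  allCoords-true (x ∷ c) = allCoords-true c

  length-allBelow : ∀ {m} (β : Fin m → ℕ) → length (allBelow 𝒢 (Vec.tabulate β)) ≡ ∏ β
  length-allBelow β = begin
    length B                                       ≡⟨ sym (trans (count-const true B) (ℕP.*-identityˡ (length B))) ⟩
    count (λ _ → true) B                           ≡⟨ count-cong (λ c → sym (allCoords-true c)) B ⟩
    count (allCoords (λ _ _ → true)) B             ≡⟨ box-count β (λ _ _ → true) ⟩
    ∏ (λ i → count (λ _ → true) (List.upTo (β i)))
      ≡⟨ ∏-cong-≗ (λ i → trans (count-const true (List.upTo (β i))) (trans (ℕP.*-identityˡ _) (ListP.length-upTo (β i)))) ⟩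
    ∏ β                                            ∎
    where
    open ≡-Reasoning
    B = allBelow 𝒢 (Vec.tabulate β)

-- Refining an edge list

module _ {B : Set} where

  fill : (ys : List B) {zs : List B} → ℚ → (Fin (length zs) → ℚ) → Fin (length (ys List.++ zs)) → ℚ
  fill []       c g i       = g i
  fill (y ∷ ys) c g zero    = c
  fill (y ∷ ys) c g (suc i) = fill ys c g i

  Σℚ-fill : ∀ (F : B → ℚ → ℚ) ys {zs} c g →
            Σℚ (λ i → F (lookup (ys List.++ zs) i) (fill ys c g i))
            ≡ sumℚ (List.map (λ y → F y c) ys) + Σℚ (λ i → F (lookup zs i) (g i))
  Σℚ-fill F []       c g = sym (ℚP.+-identityˡ _)
  Σℚ-fill F (y ∷ ys) {zs} c g = begin
    Σℚ (λ i → F (lookup (y ∷ ys List.++ zs) i) (fill (y ∷ ys) c g i))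
      ≡⟨ Σℚ-suc (λ i → F (lookup (y ∷ ys List.++ zs) i) (fill (y ∷ ys) c g i)) ⟩
    F y c + (Σℚ rest)                                                  ≡⟨ cong (F y c +_) (Σℚ-fill F ys c g) ⟩
    F y c + (sumℚ (List.map (λ y → F y c) ys) + Σℚ after)
      ≡⟨ sym (ℚP.+-assoc (F y c) (sumℚ (List.map (λ y → F y c) ys)) (Σℚ after)) ⟩
    F y c + sumℚ (List.map (λ y → F y c) ys) + Σℚ after                 ∎
    where
    open ≡-Reasoning
    rest : Fin (length (ys List.++ zs)) → ℚ
    rest i = F (lookup (ys List.++ zs) i) (fill ys c g i)
    after : Fin (length zs) → ℚ
    after i = F (lookup zs i) (g i)

  fill-All : ∀ (P : B → ℚ → Set) ys {zs} {c g} → All (λ y → P y c) ys → (∀ i → P (lookup zs i) (g i)) →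
             ∀ i → P (lookup (ys List.++ zs) i) (fill ys c g i)
  fill-All P []       []         Pg i       = Pg i
  fill-All P (y ∷ ys) (Py ∷ Pys) Pg zero    = Py
  fill-All P (y ∷ ys) (Py ∷ Pys) Pg (suc i) = fill-All P ys Pys Pg i

module Refinement {A A′ B : Set} (coarse : A → A′) (fine : A → List B) (share : A → ℚ → ℚ) where

  refine : ∀ xs → (Fin (length (List.map coarse xs)) → ℚ) → Fin (length (List.concatMap fine xs)) → ℚ
  refine []       f ()
  refine (x ∷ xs) f = fill (fine x) (share x (f zero)) (refine xs (f ∘ suc))

  Σℚ-refine : ∀ (F : B → ℚ → ℚ) (G : A′ → ℚ → ℚ) →
              (∀ x a → sumℚ (List.map (λ y → F y (share x a)) (fine x)) ≡ G (coarse x) a) →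
              ∀ xs f → Σℚ (λ i → F (lookup (List.concatMap fine xs) i) (refine xs f i))
                       ≡ Σℚ (λ j → G (lookup (List.map coarse xs) j) (f j))
  Σℚ-refine F G blocks []       f = refl
  Σℚ-refine F G blocks (x ∷ xs) f = begin
    Σℚ (λ i → F (lookup (List.concatMap fine (x ∷ xs)) i) (refine (x ∷ xs) f i))
      ≡⟨ Σℚ-fill F (fine x) (share x (f zero)) (refine xs (f ∘ suc)) ⟩
    sumℚ (List.map (λ y → F y (share x (f zero))) (fine x)) + Σℚ (λ i → F (lookup (List.concatMap fine xs) i) (refine xs (f ∘ suc) i))
      ≡⟨ cong₂ _+_ (blocks x (f zero)) (Σℚ-refine F G blocks xs (f ∘ suc)) ⟩
    G (coarse x) (f zero) + Σℚ (λ j → G (lookup (List.map coarse xs) j) (f (suc j)))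
      ≡⟨ sym (Σℚ-suc (λ j → G (lookup (List.map coarse (x ∷ xs)) j) (f j))) ⟩
    Σℚ (λ j → G (lookup (List.map coarse (x ∷ xs)) j) (f j)) ∎
    where open ≡-Reasoning

  refine-All : ∀ (P : B → ℚ → Set) (Q : A′ → ℚ → Set) → (∀ x a → Q (coarse x) a → All (λ y → P y (share x a)) (fine x)) →
               ∀ xs f → (∀ j → Q (lookup (List.map coarse xs) j) (f j)) → ∀ i → P (lookup (List.concatMap fine xs) i) (refine xs f i)
  refine-All P Q blocks []       f Qf ()
  refine-All P Q blocks (x ∷ xs) f Qf = fill-All P (fine x) (blocks x (f zero) (Qf zero)) (refine-All P Q blocks xs (f ∘ suc) (Qf ∘ suc))

-- Lifting flows and cuts to the instantiation

module Instantiation (𝒢 : ParamGraphTemplate) (wf : WellFormed 𝒢) where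

  open ParamGraphTemplate 𝒢
  open Boxes 𝒢

  instance
    P≢0 : ∀ {i} → ℕ.NonZero (P i)
    P≢0 {i} = ℕ.>-nonZero (WellFormed.paramPos wf i)

  bound : Fin n → Fin n → Fin (suc k) → ℕ
  bound u v i = if T i u ∨ T i v then P i else 1

  copies : Fin n → ℕ
  copies z = ∏ (λ i → if T i z then P i else 1)

  if-P-nonZero : ∀ b i → ℕ.NonZero (if b then P i else 1)
  if-P-nonZero true  i = P≢0
  if-P-nonZero false i = _

  factor≡∏ : ∀ u v → factor 𝒢 u v ≡ ∏ (bound u v)
  factor≡∏ u v = product-allFin (bound u v)

  instance
    factor≢0 : ∀ {u v} → ℕ.NonZero (factor 𝒢 u v)
    factor≢0 {u} {v} = subst ℕ.NonZero (sym (factor≡∏ u v)) (∏-nonZero (bound u v) (λ i → if-P-nonZero (T i u ∨ T i v) i))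
    copies≢0 : ∀ {z} → ℕ.NonZero (copies z)
    copies≢0 {z} = ∏-nonZero _ (λ i → if-P-nonZero (T i z) i)

  -- (z , c₀) is an instance of z iff the numerator is 1; then κ z c₀ is 1 over the number of instances of z.
  κ : Fin n → Vec ℕ (suc k) → ℚ
  κ z c₀ = ι (∏ (λ i → admissible (T i z) (P i) (Vec.lookup c₀ i))) * 1/ ι (copies z)

  incidence-ratio : ∀ u v z c₀ → (∀ i → T i z ≡ true → (T i u ∨ T i v) ≡ true) →
    ι (count (λ c → ⌊ restrict 𝒢 z c ≟ⱽ c₀ ⌋) (allBelow 𝒢 (edgeBound 𝒢 u v))) * 1/ ι (factor 𝒢 u v) ≡ κ z c₀
  incidence-ratio u v z c₀ z∈e = begin
    ι (count (λ c → ⌊ restrict 𝒢 z c ≟ⱽ c₀ ⌋) (allBelow 𝒢 (edgeBound 𝒢 u v))) * 1/ ι (factor 𝒢 u v)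
      ≡⟨ cong₂ _*_ (cong ι count≡) (1/ι-cong factor≡) ⟩
    ι (A ℕ.* F) * 1/ ι (copies z ℕ.* F) ≡⟨ ι-ratio-cancel A (copies z) F ⟩
    κ z c₀                              ∎
    where
    open ≡-Reasoning
    A = ∏ (λ i → admissible (T i z) (P i) (Vec.lookup c₀ i))
    F = ∏ (λ i → free (T i z) (bound u v i))
    on-z : ∀ i → T i z ≡ true → bound u v i ≡ P i
    on-z i z∈Tᵢ rewrite z∈e i z∈Tᵢ = refl
    free-nonZero : ∀ i → ℕ.NonZero (free (T i z) (bound u v i))
    free-nonZero i with T i z
    ... | true  = _
    ... | false = if-P-nonZero (T i u ∨ T i v) i
    instance
      F≢0 : ℕ.NonZero F
      F≢0 = ∏-nonZero _ free-nonZero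
      copies*F≢0 : ℕ.NonZero (copies z ℕ.* F)
      copies*F≢0 = ℕP.m*n≢0 (copies z) F
    admissible-on-z : ∀ i → admissible (T i z) (bound u v i) (Vec.lookup c₀ i) ≡ admissible (T i z) (P i) (Vec.lookup c₀ i)
    admissible-on-z i with T i z in z∈Tᵢ
    ... | true  rewrite on-z i z∈Tᵢ = refl
    ... | false = refl
    count≡ : count (λ c → ⌊ restrict 𝒢 z c ≟ⱽ c₀ ⌋) (allBelow 𝒢 (edgeBound 𝒢 u v)) ≡ A ℕ.* F
    count≡ = trans (fibre-count (λ i → T i z) (bound u v) c₀) (cong (ℕ._* F) (∏-cong-≗ admissible-on-z))
    split : ∀ i → bound u v i ≡ (if T i z then P i else 1) ℕ.* free (T i z) (bound u v i)
    split i with T i z in z∈Tᵢ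
    ... | true  = trans (on-z i z∈Tᵢ) (sym (ℕP.*-identityʳ (P i)))
    ... | false = sym (ℕP.*-identityˡ (bound u v i))
    factor≡ : factor 𝒢 u v ≡ copies z ℕ.* F
    factor≡ = trans (factor≡∏ u v)
      (trans (∏-cong-≗ split) (∏-distrib-* (λ i → if T i z then P i else 1) (λ i → free (T i z) (bound u v i))))

  ≟I-pair : ∀ x z (y c₀ : Vec ℕ (suc k)) → ⌊ _≟I_ 𝒢 (x , y) (z , c₀) ⌋ ≡ ⌊ x FinP.≟ z ⌋ ∧ ⌊ y ≟ⱽ c₀ ⌋
  ≟I-pair x z y c₀ with x FinP.≟ z
  ... | no _     = refl
  ... | yes refl = ⌊⌋-map′ _ _ (y ≟ⱽ c₀)

  share : Edge (Fin n) → ℚ → ℚ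
  share e a = a * 1/ ι (factor 𝒢 (tail e) (head e))

  ι-factor*share : ∀ e a → ι (factor 𝒢 (tail e) (head e)) * share e a ≡ a
  ι-factor*share e a = begin
    ι F * (a * 1/ ι F) ≡⟨ solve 3 (λ f a u → f :* (a :* u) := a :* (f :* u)) refl (ι F) a (1/ ι F) ⟩
    a * (ι F * 1/ ι F) ≡⟨ cong (a *_) (ℚP.*-inverseʳ (ι F)) ⟩
    a * 1ℚ             ≡⟨ ℚP.*-identityʳ a ⟩
    a                  ∎
    where
    open ≡-Reasoning
    F = factor 𝒢 (tail e) (head e)

  endpoint-block : ∀ u v w x z c₀ a → (∀ i → T i x ≡ true → (T i u ∨ T i v) ≡ true) →
    sumℚ (List.map (λ c → if ⌊ _≟I_ 𝒢 (x , restrict 𝒢 x c) (z , c₀) ⌋ then share (u , v , w) a else 0ℚ) (allBelow 𝒢 (edgeBound 𝒢 u v)))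
    ≡ (if ⌊ x FinP.≟ z ⌋ then a else 0ℚ) * κ z c₀
  endpoint-block u v w x z c₀ a x∈e = begin
    sumℚ (List.map (λ c → if ⌊ _≟I_ 𝒢 (x , restrict 𝒢 x c) (z , c₀) ⌋ then σ else 0ℚ) L)
      ≡⟨ cong sumℚ (ListP.map-cong (λ c → cong (if_then σ else 0ℚ) (≟I-pair x z (restrict 𝒢 x c) c₀)) L) ⟩
    sumℚ (List.map (λ c → if ⌊ x FinP.≟ z ⌋ ∧ ⌊ restrict 𝒢 x c ≟ⱽ c₀ ⌋ then σ else 0ℚ) L)
      ≡⟨ sumℚ-if (λ c → ⌊ x FinP.≟ z ⌋ ∧ ⌊ restrict 𝒢 x c ≟ⱽ c₀ ⌋) σ L ⟩
    ι (count (λ c → ⌊ x FinP.≟ z ⌋ ∧ ⌊ restrict 𝒢 x c ≟ⱽ c₀ ⌋) L) * σ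
      ≡⟨ cong (λ m → ι m * σ) (count-∧ ⌊ x FinP.≟ z ⌋ (λ c → ⌊ restrict 𝒢 x c ≟ⱽ c₀ ⌋) L) ⟩
    ι (χℕ ⌊ x FinP.≟ z ⌋ ℕ.* N) * σ
      ≡⟨ by-cases (x FinP.≟ z) ⟩
    (if ⌊ x FinP.≟ z ⌋ then a else 0ℚ) * κ z c₀ ∎
    where
    open ≡-Reasoning
    L = allBelow 𝒢 (edgeBound 𝒢 u v)
    N = count (λ c → ⌊ restrict 𝒢 x c ≟ⱽ c₀ ⌋) L
    σ = share (u , v , w) a
    by-cases : (x≟z : Dec (x ≡ z)) → ι (χℕ ⌊ x≟z ⌋ ℕ.* N) * σ ≡ (if ⌊ x≟z ⌋ then a else 0ℚ) * κ z c₀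
    by-cases (no _)     = trans (cong (_* σ) ι-0) (trans (ℚP.*-zeroˡ σ) (sym (ℚP.*-zeroˡ (κ z c₀))))
    by-cases (yes refl) = begin
      ι (N ℕ.+ 0) * (a * 1/ ι (factor 𝒢 u v)) ≡⟨ cong (λ m → ι m * σ) (ℕP.+-identityʳ N) ⟩
      ι N * (a * 1/ ι (factor 𝒢 u v))         ≡⟨ solve 3 (λ m a d → m :* (a :* d) := a :* (m :* d)) refl (ι N) a (1/ ι (factor 𝒢 u v)) ⟩
      a * (ι N * 1/ ι (factor 𝒢 u v))         ≡⟨ cong (a *_) (incidence-ratio u v x c₀ x∈e) ⟩
      a * κ x c₀                              ∎

  in-block : ∀ e z c₀ a → sumℚ (List.map (λ b → if ⌊ _≟I_ 𝒢 (head b) (z , c₀) ⌋ then share e a else 0ℚ) (instancesOf 𝒢 e))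
                          ≡ (if ⌊ head e FinP.≟ z ⌋ then a else 0ℚ) * κ z c₀
  in-block (u , v , w) z c₀ a = trans (cong sumℚ (sym (ListP.map-∘ (allBelow 𝒢 (edgeBound 𝒢 u v)))))
    (endpoint-block u v w v z c₀ a (λ i v∈Tᵢ → trans (cong (T i u ∨_) v∈Tᵢ) (BoolP.∨-zeroʳ (T i u))))

  out-block : ∀ e z c₀ a → sumℚ (List.map (λ b → if ⌊ _≟I_ 𝒢 (tail b) (z , c₀) ⌋ then share e a else 0ℚ) (instancesOf 𝒢 e))
                           ≡ (if ⌊ tail e FinP.≟ z ⌋ then a else 0ℚ) * κ z c₀
  out-block (u , v , w) z c₀ a = trans (cong sumℚ (sym (ListP.map-∘ (allBelow 𝒢 (edgeBound 𝒢 u v)))))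
    (endpoint-block u v w u z c₀ a (λ i u∈Tᵢ → cong (_∨ T i v) u∈Tᵢ))

  const-block : ∀ u v w (F : Edge (InstVertex 𝒢) → ℚ) K → (∀ c → F ((u , restrict 𝒢 u c) , (v , restrict 𝒢 v c) , w) ≡ K) →
                sumℚ (List.map F (instancesOf 𝒢 (u , v , w))) ≡ ι (factor 𝒢 u v) * K
  const-block u v w F K F≡K = begin
    sumℚ (List.map F (instancesOf 𝒢 (u , v , w))) ≡⟨ cong sumℚ (sym (ListP.map-∘ L)) ⟩
    sumℚ (List.map (λ c → F ((u , restrict 𝒢 u c) , (v , restrict 𝒢 v c) , w)) L) ≡⟨ cong sumℚ (ListP.map-cong F≡K L) ⟩
    sumℚ (List.map (λ _ → K) L) ≡⟨ sumℚ-const K L ⟩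
    ι (length L) * K            ≡⟨ cong (λ m → ι m * K) (trans (length-allBelow (bound u v)) (sym (factor≡∏ u v))) ⟩
    ι (factor 𝒢 u v) * K        ∎
    where
    open ≡-Reasoning
    L = allBelow 𝒢 (edgeBound 𝒢 u v)

  share-bounds : ∀ e a → 0ℚ ≤ a → a ≤ cap (reweightEdge 𝒢 e) → 0ℚ ≤ share e a × share e a ≤ cap e
  share-bounds (u , v , w) a 0≤a a≤w′ =
    *-nonNeg 0≤a (ℚP.<⇒≤ (ℚP.positive⁻¹ (1/ ι F) {{1/ι-positive F}})) ,
    (begin
      a * 1/ ι F                           ≤⟨ ℚP.*-monoʳ-≤-nonNeg (1/ ι F) {{ℚP.pos⇒nonNeg (1/ ι F) {{1/ι-positive F}}}} a≤w′ ⟩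
      w * (ℤ.+ F / 1) * 1/ ι F             ≡⟨ cong (λ y → w * y * 1/ ι F) (n/1≡ι F) ⟩
      w * ι F * 1/ ι F                     ≡⟨ ℚP.*-assoc w (ι F) (1/ ι F) ⟩
      w * (ι F * 1/ ι F)                   ≡⟨ cong (w *_) (ℚP.*-inverseʳ (ι F)) ⟩
      w * 1ℚ                               ≡⟨ ℚP.*-identityʳ w ⟩
      w                                    ∎)
    where
    open ℚP.≤-Reasoning
    F = factor 𝒢 u v

  module Lift (s t : Fin n) where

    module G′ = FlowTheory FinP._≟_ (reweighted 𝒢) (λ x → ⌊ x FinP.≟ s ⌋) (λ x → ⌊ x FinP.≟ t ⌋)
    module GI = FlowTheory (_≟I_ 𝒢) (instEdges 𝒢) (λ y → ⌊ proj₁ y FinP.≟ s ⌋) (λ y → ⌊ proj₁ y FinP.≟ t ⌋)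
    open Refinement (reweightEdge 𝒢) (instancesOf 𝒢) share

    lift : G′.Assignment → GI.Assignment
    lift = refine edges

    lift-inflow : ∀ f z c₀ → GI.inflow (lift f) (z , c₀) ≡ G′.inflow f z * κ z c₀
    lift-inflow f z c₀ = trans (Σℚ-refine (λ b a → if ⌊ _≟I_ 𝒢 (head b) (z , c₀) ⌋ then a else 0ℚ)
                                          (λ e′ a → (if ⌊ head e′ FinP.≟ z ⌋ then a else 0ℚ) * κ z c₀)
                                          (λ e a → in-block e z c₀ a) edges f)
                               (Σℚ-*ʳ (λ j → if ⌊ head (lookup (reweighted 𝒢) j) FinP.≟ z ⌋ then f j else 0ℚ) (κ z c₀))

    lift-outflow : ∀ f z c₀ → GI.outflow (lift f) (z , c₀) ≡ G′.outflow f z * κ z c₀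
    lift-outflow f z c₀ = trans (Σℚ-refine (λ b a → if ⌊ _≟I_ 𝒢 (tail b) (z , c₀) ⌋ then a else 0ℚ)
                                           (λ e′ a → (if ⌊ tail e′ FinP.≟ z ⌋ then a else 0ℚ) * κ z c₀)
                                           (λ e a → out-block e z c₀ a) edges f)
                                (Σℚ-*ʳ (λ j → if ⌊ tail (lookup (reweighted 𝒢) j) FinP.≟ z ⌋ then f j else 0ℚ) (κ z c₀))

    lift-value : ∀ f → GI.value (lift f) ≡ G′.value f
    lift-value f = Σℚ-refine (λ b a → a * (χ ⌊ proj₁ (tail b) FinP.≟ s ⌋ - χ ⌊ proj₁ (head b) FinP.≟ s ⌋))
                             (λ e′ a → a * (χ ⌊ tail e′ FinP.≟ s ⌋ - χ ⌊ head e′ FinP.≟ s ⌋)) block edges f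
      where
      block : ∀ e a → sumℚ (List.map (λ b → share e a * (χ ⌊ proj₁ (tail b) FinP.≟ s ⌋ - χ ⌊ proj₁ (head b) FinP.≟ s ⌋))
                                     (instancesOf 𝒢 e))
                      ≡ a * (χ ⌊ tail e FinP.≟ s ⌋ - χ ⌊ head e FinP.≟ s ⌋)
      block e@(u , v , w) a = trans (const-block u v w _ (share e a * d) (λ _ → refl))
        (trans (sym (ℚP.*-assoc (ι (factor 𝒢 u v)) (share e a) d)) (cong (_* d) (ι-factor*share e a)))
        where d = χ ⌊ u FinP.≟ s ⌋ - χ ⌊ v FinP.≟ s ⌋

    lift-cutCapacity : ∀ S → GI.cutCapacity (S ∘ proj₁) ≡ G′.cutCapacity S
    lift-cutCapacity S = Σℚ-refine (λ b _ → χ (S (proj₁ (tail b)) ∧ not (S (proj₁ (head b)))) * cap b)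
                                   (λ e′ _ → χ (S (tail e′) ∧ not (S (head e′))) * cap e′) block edges (λ _ → 0ℚ)
      where
      block : ∀ e (a : ℚ) → sumℚ (List.map (λ b → χ (S (proj₁ (tail b)) ∧ not (S (proj₁ (head b)))) * cap b) (instancesOf 𝒢 e))
                            ≡ χ (S (tail e) ∧ not (S (head e))) * cap (reweightEdge 𝒢 e)
      block (u , v , w) _ = begin
        sumℚ (List.map (λ b → χ (S (proj₁ (tail b)) ∧ not (S (proj₁ (head b)))) * cap b) (instancesOf 𝒢 (u , v , w)))
                                 ≡⟨ const-block u v w _ (x * w) (λ _ → refl) ⟩
        ι F * (x * w)            ≡⟨ solve 3 (λ f x w → f :* (x :* w) := x :* (w :* f)) refl (ι F) x w ⟩
        x * (w * ι F)            ≡⟨ cong (λ y → x * (w * y)) (sym (n/1≡ι F)) ⟩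
        x * (w * (ℤ.+ F / 1))    ∎
        where
        open ≡-Reasoning
        F = factor 𝒢 u v
        x = χ (S u ∧ not (S v))

    lift-flow : ∀ {f} → G′.IsFlow f → GI.IsFlow (lift f)
    lift-flow {f} flow = record
      { nonneg       = λ i → proj₁ (bounds i)
      ; capacity     = λ i → proj₂ (bounds i)
      ; conservation = λ { (z , c₀) z∉src z∉snk → begin
          GI.inflow (lift f) (z , c₀)  ≡⟨ lift-inflow f z c₀ ⟩
          G′.inflow f z * κ z c₀       ≡⟨ cong (_* κ z c₀) (G′.IsFlow.conservation flow z z∉src z∉snk) ⟩
          G′.outflow f z * κ z c₀      ≡⟨ sym (lift-outflow f z c₀) ⟩
          GI.outflow (lift f) (z , c₀) ∎ }
      }
      where
      open ≡-Reasoning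
      bounds : ∀ i → 0ℚ ≤ lift f i × lift f i ≤ cap (lookup (instEdges 𝒢) i)
      bounds = refine-All (λ b a → 0ℚ ≤ a × a ≤ cap b) (λ e′ a → 0ℚ ≤ a × a ≤ cap e′)
        (λ e a (0≤a , a≤cap) → AllP.map⁺ (All.universal (λ _ → share-bounds e a 0≤a a≤cap) (allBelow 𝒢 (edgeBound 𝒢 (tail e) (head e)))))
        edges f (λ j → G′.IsFlow.nonneg flow j , G′.IsFlow.capacity flow j)

    lift-cut : ∀ {S} → G′.IsCut S → GI.IsCut (S ∘ proj₁)
    lift-cut cut = record { sources⊆S = sources⊆S ∘ proj₁ ; sinks∩S⊆sources = sinks∩S⊆sources ∘ proj₁ }
      where open G′.IsCut cut

lemma1 : (𝒢 : ParamGraphTemplate) → WellFormed 𝒢 →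
         (s t : Fin (ParamGraphTemplate.n 𝒢)) →
         Σ ℚ (λ x → MaxFlowValueReweighted 𝒢 s t x × MaxAllFlowValue 𝒢 s t x)
lemma1 𝒢 wf s t =
  let f , flow , S , cut , value≡cap = max-flow-min-cut (reweighted 𝒢) _ _ reweighted-nonneg
  in G′.cutCapacity S ,
     G′.tight⇒maxFlowValue flow cut value≡cap ,
     subst GI.IsMaxFlowValue (lift-cutCapacity S)
       (GI.tight⇒maxFlowValue (lift-flow flow) (lift-cut cut) (trans (lift-value f) (trans value≡cap (sym (lift-cutCapacity S)))))
  where
  open Instantiation 𝒢 wf
  open Lift s t
  reweighted-nonneg : All (λ e → 0ℚ ≤ cap e) (reweighted 𝒢)
  reweighted-nonneg = AllP.map⁺ (All.map (λ {e} 0≤w → *-nonNeg 0≤w (0≤factor e)) (WellFormed.nonnegWeights wf))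
    where
    0≤factor : ∀ e → 0ℚ ≤ ℤ.+ factor 𝒢 (tail e) (head e) / 1
    0≤factor e = subst (0ℚ ≤_) (sym (n/1≡ι (factor 𝒢 (tail e) (head e)))) (0≤ι (factor 𝒢 (tail e) (head e)))
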